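{- Let $a\ge 1$, $i\in\{ -1,1\}$ and $n=4a+4+i\ge 9$. Let $\Omega$ be the set of points $1,\dots,2a,1',\dots,(2a)',\alpha,\alpha',\beta,\beta'$, together with two further points $\gamma,\delta$ when $i=1$. Define on $\Omega$ $$t=(\alpha,\alpha')(\beta,\beta')\prod_{j=1}^{2a}(j,j'),$$ $$s=(1,2,\dots,2a,\alpha,\alpha',\beta,(2a)',(2a-1)',\dots,2',1')\quad\text{if } i=-1,$$ $$s=(1,2,\dots,2a,\alpha,\beta,\gamma,\alpha',(2a)',(2a-1)',\dots,2',1',\delta)\quad\text{if } i=1,$$ and let $G=\langle s,t\rangle$ and $r=ts^{ -1}$. Then $G=A_{n+1}$ (the alternating group on $\Omega$), and $\mathcal{M}(G:r,s)$ is a chiral map of type $\{4,n\}$.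
   Context: Permutations act on the right and products are composed left to right; primed symbols $j'$ are points distinct from $j$. For a finite group $G$ generated by $r,s$ with $rs$ an involution, $\mathcal{M}(G:r,s)$ denotes the orientably-regular map with orientation-preserving automorphism group $G$ in which $r$ and $s$ are one-step rotations about a face and an incident vertex; it has type $\{m,n\}$ where $m,n$ are the orders of $r,s$. It is chiral if there is no automorphism of $G$ sending $r\mapsto r^{ -1}$, $s\mapsto s^{ -1}$. -}

module Defs where

open import Data.Nat using (ℕ; zero; suc; _+_; _*_; _≤_; _<_)
open import Data.Nat.Divisibility using (_∣_)
open import Data.Fin using (Fin; zero; suc; fromℕ; inject₁)
open import Data.Maybe using (Maybe; just; nothing; maybe′)
import Data.Maybe as Maybe
open import Data.Product using (Σ; ∃; ∃₂; _×_; _,_; proj₁; proj₂)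
open import Data.List using (List; []; _∷_; length; foldr)
open import Data.List.Relation.Unary.All using (All)
open import Relation.Binary.PropositionalEquality
open import Relation.Nullary using (¬_)

-- Permutations of a set X (bijections with explicit inverse).
-- They act on the right; products are composed left to right.

record Perm (X : Set) : Set where
  constructor perm
  field
    to      : X → X
    from    : X → X
    to∘from : ∀ x → to (from x) ≡ x
    from∘to : ∀ x → from (to x) ≡ x
open Perm public

module _ {X : Set} where

  _≈ₚ_ : Perm X → Perm X → Set
  p ≈ₚ q = ∀ x → to p x ≡ to q x

  idP : Perm X
  idP = perm (λ x → x) (λ x → x) (λ _ → refl) (λ _ → refl)

  _⨾_ : Perm X → Perm X → Perm X
  p ⨾ q = perm (λ x → to q (to p x)) (λ x → from p (from q x))
    (λ x → trans (cong (to q) (to∘from p (from q x))) (to∘from q x))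
    (λ x → trans (cong (from p) (from∘to q (to p x))) (from∘to p x))

  _⁻¹ : Perm X → Perm X
  p ⁻¹ = perm (from p) (to p) (from∘to p) (to∘from p)

  _^_ : Perm X → ℕ → Perm X
  p ^ zero  = idP
  p ^ suc k = (p ^ k) ⨾ p

  HasOrder : Perm X → ℕ → Set
  HasOrder p m = 1 ≤ m × (p ^ m) ≈ₚ idP × (∀ k → 1 ≤ k → k < m → ¬ ((p ^ k) ≈ₚ idP))

  data Gen (g h : Perm X) : Perm X → Set where
    gen₁ : Gen g h g
    gen₂ : Gen g h h
    unit : Gen g h idP
    mul  : ∀ {p q} → Gen g h p → Gen g h q → Gen g h (p ⨾ q)
    inv  : ∀ {p} → Gen g h p → Gen g h (p ⁻¹)

  _∈⟨_,_⟩ : Perm X → Perm X → Perm X → Set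
  p ∈⟨ g , h ⟩ = ∃ λ q → Gen g h q × q ≈ₚ p

  IsTransposition : Perm X → Set
  IsTransposition p = ∃₂ λ x y → ¬ (x ≡ y) × to p x ≡ y × to p y ≡ x
                        × (∀ z → ¬ (z ≡ x) → ¬ (z ≡ y) → to p z ≡ z)

  product : List (Perm X) → Perm X
  product = foldr _⨾_ idP

  IsEven : Perm X → Set
  IsEven p = ∃ λ (ts : List (Perm X)) → All IsTransposition ts × 2 ∣ length ts × product ts ≈ₚ p

  record Automorphism (H : Perm X → Set) : Set where
    field
      φ      : Σ (Perm X) H → Σ (Perm X) H
      φ-cong : ∀ u v → proj₁ u ≈ₚ proj₁ v → proj₁ (φ u) ≈ₚ proj₁ (φ v)
      φ-hom  : ∀ p q (hp : H p) (hq : H q) (hpq : H (p ⨾ q)) →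
               proj₁ (φ (p ⨾ q , hpq)) ≈ₚ (proj₁ (φ (p , hp)) ⨾ proj₁ (φ (q , hq)))
      φ-inj  : ∀ u v → proj₁ (φ u) ≈ₚ proj₁ (φ v) → proj₁ u ≈ₚ proj₁ v
      φ-surj : ∀ (v : Σ (Perm X) H) → Σ (Σ (Perm X) H) λ u → proj₁ (φ u) ≈ₚ proj₁ v

  -- M(G : r , s) is chiral: no automorphism of G sends r ↦ r⁻¹ and s ↦ s⁻¹
  IsChiral : (G : Perm X → Set) → Perm X → Perm X → Set
  IsChiral G r s = ¬ (Σ (Automorphism G) λ A →
      (∀ u → proj₁ u ≈ₚ r → proj₁ (Automorphism.φ A u) ≈ₚ (r ⁻¹))
    × (∀ u → proj₁ u ≈ₚ s → proj₁ (Automorphism.φ A u) ≈ₚ (s ⁻¹)))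

nxt : ∀ {m} → Fin m → Maybe (Fin m)
nxt {suc zero} zero = nothing
nxt {suc zero} (suc ())
nxt {suc (suc m)} zero = just (suc zero)
nxt {suc (suc m)} (suc j) = Maybe.map suc (nxt j)

prv : ∀ {m} → Fin m → Maybe (Fin m)
prv zero = nothing
prv (suc j) = just (inject₁ j)

firstM : ∀ m → Maybe (Fin m)
firstM zero = nothing
firstM (suc m) = just zero

lastM : ∀ m → Maybe (Fin m)
lastM zero = nothing
lastM (suc m) = just (fromℕ m)

prv-suc : ∀ {m} (k j : Fin (suc m)) → prv k ≡ just j → prv (suc k) ≡ just (suc j)
prv-suc zero j ()
prv-suc (suc k) .(inject₁ k) refl = refl

nxt-prv : ∀ {m} (j k : Fin m) → nxt j ≡ just k → prv k ≡ just j
nxt-prv {suc zero} zero k ()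
nxt-prv {suc (suc m)} zero .(suc zero) refl = refl
nxt-prv {suc (suc m)} (suc j) k eq with nxt j in e
nxt-prv {suc (suc m)} (suc j) .(suc k') refl | just k' = prv-suc k' j (nxt-prv j k' e)

prv-nxt : ∀ {m} (k j : Fin m) → prv k ≡ just j → nxt j ≡ just k
prv-nxt zero j ()
prv-nxt {suc (suc m)} (suc zero) .zero refl = refl
prv-nxt {suc (suc m)} (suc (suc k)) .(suc (inject₁ k)) refl
  rewrite prv-nxt (suc k) (inject₁ k) refl = refl

nxt-last : ∀ {m} (j : Fin m) → nxt j ≡ nothing → lastM m ≡ just j
nxt-last {suc zero} zero e = refl
nxt-last {suc (suc m)} (suc j) e with nxt j in e'
nxt-last {suc (suc m)} (suc j) refl | nothing with nxt-last j e'
... | r = cong (Maybe.map suc) r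

last-nxt : ∀ {m} (j : Fin m) → lastM m ≡ just j → nxt j ≡ nothing
last-nxt {suc zero} zero refl = refl
last-nxt {suc (suc m)} .(suc (fromℕ m)) refl rewrite last-nxt {suc m} (fromℕ m) refl = refl

prv-first : ∀ {m} (j : Fin m) → prv j ≡ nothing → firstM m ≡ just j
prv-first zero e = refl

first-prv : ∀ {m} (j : Fin m) → firstM m ≡ just j → prv j ≡ nothing
first-prv {suc m} .zero refl = refl

last-first : ∀ m → lastM m ≡ nothing → firstM m ≡ nothing
last-first zero e = refl

first-last : ∀ m → firstM m ≡ nothing → lastM m ≡ nothing
first-last zero e = refl

data Sgn : Set where
  minus plus : Sgn

-- n = 4a + 4 + i
nOf : ℕ → Sgn → ℕ
nOf a minus = 4 * a + 3
nOf a plus  = 4 * a + 5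

-- Ω : points 1..2a (num j), 1'..(2a)' (num' j), α, α', β, β', and γ, δ when i = 1.
-- num j / num' j with j : Fin (2a) stand for the points (j+1) / (j+1)'.
data Pt (a : ℕ) : Sgn → Set where
  num num' : ∀ {i} → Fin (2 * a) → Pt a i
  α α' β β' : ∀ {i} → Pt a i
  γ δ : Pt a plus

module _ {a : ℕ} where

  tfun : ∀ {i} → Pt a i → Pt a i
  tfun (num j) = num' j
  tfun (num' j) = num j
  tfun α = α'
  tfun α' = α
  tfun β = β'
  tfun β' = β
  tfun γ = γ
  tfun δ = δ

  tfun-inv : ∀ {i} (x : Pt a i) → tfun (tfun x) ≡ x
  tfun-inv (num j) = refl
  tfun-inv (num' j) = refl
  tfun-inv α = refl
  tfun-inv α' = refl
  tfun-inv β = refl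
  tfun-inv β' = refl
  tfun-inv γ = refl
  tfun-inv δ = refl

  tPerm : ∀ i → Perm (Pt a i)
  tPerm i = perm tfun tfun tfun-inv tfun-inv

  -- s = (1,2,…,2a,α,α',β,(2a)',…,2',1')                if i = -1
  -- s = (1,2,…,2a,α,β,γ,α',(2a)',…,2',1',δ)            if i = 1
  sfun : ∀ {i} → Pt a i → Pt a i
  sfun {minus} (num j) = maybe′ num α (nxt j)
  sfun {minus} (num' j) = maybe′ num' (num j) (prv j)
  sfun {minus} α = α'
  sfun {minus} α' = β
  sfun {minus} β = maybe′ num' α (lastM (2 * a))
  sfun {minus} β' = β'
  sfun {plus} (num j) = maybe′ num α (nxt j)
  sfun {plus} (num' j) = maybe′ num' δ (prv j)
  sfun {plus} α = β
  sfun {plus} β = γ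
  sfun {plus} γ = α'
  sfun {plus} α' = maybe′ num' δ (lastM (2 * a))
  sfun {plus} δ = maybe′ num α (firstM (2 * a))
  sfun {plus} β' = β'

  sinv : ∀ {i} → Pt a i → Pt a i
  sinv {minus} (num j) = maybe′ num (num' j) (prv j)
  sinv {minus} (num' j) = maybe′ num' β (nxt j)
  sinv {minus} α = maybe′ num β (lastM (2 * a))
  sinv {minus} α' = α
  sinv {minus} β = α'
  sinv {minus} β' = β'
  sinv {plus} (num j) = maybe′ num δ (prv j)
  sinv {plus} (num' j) = maybe′ num' α' (nxt j)
  sinv {plus} α = maybe′ num δ (lastM (2 * a))
  sinv {plus} β = α
  sinv {plus} γ = β
  sinv {plus} α' = γ
  sinv {plus} δ = maybe′ num' α' (firstM (2 * a))
  sinv {plus} β' = β'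

  sfun-sinv : ∀ {i} (x : Pt a i) → sfun (sinv x) ≡ x
  sfun-sinv {minus} (num j) with prv j in e
  ... | just k rewrite prv-nxt j k e = refl
  ... | nothing rewrite e = refl
  sfun-sinv {minus} (num' j) with nxt j in e
  ... | just k rewrite nxt-prv j k e = refl
  ... | nothing rewrite nxt-last j e = refl
  sfun-sinv {minus} α with lastM (2 * a) in e
  ... | just k rewrite last-nxt k e = refl
  ... | nothing rewrite e = refl
  sfun-sinv {minus} α' = refl
  sfun-sinv {minus} β = refl
  sfun-sinv {minus} β' = refl
  sfun-sinv {plus} (num j) with prv j in e
  ... | just k rewrite prv-nxt j k e = refl
  ... | nothing rewrite prv-first j e = refl
  sfun-sinv {plus} (num' j) with nxt j in e
  ... | just k rewrite nxt-prv j k e = refl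
  ... | nothing rewrite nxt-last j e = refl
  sfun-sinv {plus} α with lastM (2 * a) in e
  ... | just k rewrite last-nxt k e = refl
  ... | nothing rewrite last-first (2 * a) e = refl
  sfun-sinv {plus} β = refl
  sfun-sinv {plus} γ = refl
  sfun-sinv {plus} α' = refl
  sfun-sinv {plus} δ with firstM (2 * a) in e
  ... | just k rewrite first-prv k e = refl
  ... | nothing rewrite first-last (2 * a) e = refl
  sfun-sinv {plus} β' = refl

  sinv-sfun : ∀ {i} (x : Pt a i) → sinv (sfun x) ≡ x
  sinv-sfun {minus} (num j) with nxt j in e
  ... | just k rewrite nxt-prv j k e = refl
  ... | nothing rewrite nxt-last j e = refl
  sinv-sfun {minus} (num' j) with prv j in e
  ... | just k rewrite prv-nxt j k e = refl
  ... | nothing rewrite e = refl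
  sinv-sfun {minus} β with lastM (2 * a) in e
  ... | just k rewrite last-nxt k e = refl
  ... | nothing rewrite e = refl
  sinv-sfun {minus} α = refl
  sinv-sfun {minus} α' = refl
  sinv-sfun {minus} β' = refl
  sinv-sfun {plus} (num j) with nxt j in e
  ... | just k rewrite nxt-prv j k e = refl
  ... | nothing rewrite nxt-last j e = refl
  sinv-sfun {plus} (num' j) with prv j in e
  ... | just k rewrite prv-nxt j k e = refl
  ... | nothing rewrite prv-first j e = refl
  sinv-sfun {plus} α' with lastM (2 * a) in e
  ... | just k rewrite last-nxt k e = refl
  ... | nothing rewrite last-first (2 * a) e = refl
  sinv-sfun {plus} δ with firstM (2 * a) in e
  ... | just k rewrite first-prv k e = refl
  ... | nothing rewrite first-last (2 * a) e = refl
  sinv-sfun {plus} α = refl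
  sinv-sfun {plus} β = refl
  sinv-sfun {plus} γ = refl
  sinv-sfun {plus} β' = refl

  sPerm : ∀ i → Perm (Pt a i)
  sPerm i = perm sfun sinv sfun-sinv sinv-sfun

  rPerm : ∀ i → Perm (Pt a i)
  rPerm i = tPerm i ⨾ (sPerm i ⁻¹)

  InG : ∀ i → Perm (Pt a i) → Set
  InG i p = p ∈⟨ sPerm i , tPerm i ⟩

module Submission where

open import Defs
open import Data.Nat using (ℕ; _≤_)
open import Data.Product using (_×_)
open import Function.Bundles using (_⇔_)

open import Data.Nat using (zero; suc; _+_; _*_; _∸_; _<_; _≤?_; z≤n; s≤s; z<s; s<s)
import Data.Nat.Properties as ℕ
open import Data.Nat.Divisibility using (_∣_; divides; ∣m∣n⇒∣m+n; ∣m+n∣m⇒∣n; ∣-refl; ∣1⇒≡1; m∣m*n)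
open import Data.Nat.Tactic.RingSolver using (solve-∀)
open import Data.Fin using (Fin; zero; suc; toℕ; fromℕ<)
import Data.Fin.Properties as Fin
open import Data.Maybe using (just; nothing; maybe′)
open import Data.List using (List; []; _∷_; _++_; [_]; _∷ʳ_; length; map; reverse; concat; concatMap; replicate; allFin)
open import Data.List.Properties using (length-++; length-map; length-tabulate; map-++; unfold-reverse)
open import Data.List.Membership.Propositional using (_∈_)
open import Data.List.Membership.Propositional.Properties using (∈-allFin)
open import Data.List.Relation.Unary.All as All using (All; []; _∷_; all?)
open import Data.List.Relation.Unary.All.Properties using (++⁺; map⁺)
open import Data.List.Relation.Unary.AllPairs using (_∷_)
open import Data.List.Relation.Unary.Any using (here; there)
open import Data.List.Relation.Unary.Unique.Propositional using (Unique)
open import Data.List.Relation.Unary.Unique.Propositional.Properties using (allFin⁺)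
open import Data.Product using (∃; _,_; proj₁; proj₂)
import Data.Product as Prod
open import Data.Sum using (inj₁; inj₂)
open import Data.Empty using (⊥-elim)
open import Function.Bundles using (mk⇔)
open import Relation.Nullary using (¬_; Dec; yes; no; _×-dec_)
open import Relation.Nullary.Decidable using (True; False; toWitness; toWitnessFalse; from-yes; map′)
open import Relation.Binary.Definitions using (DecidableEquality)
open import Relation.Binary.Bundles using (Setoid)
import Relation.Binary.Reasoning.Setoid as SetoidReasoning
open import Relation.Binary.PropositionalEquality hiding ([_])

-- Number the points of Ω as F 0 = β′ and F (k + 1) = sᵏ(start), with start = α for i = −1 and
-- start = β for i = 1, so that s is the n-cycle k ↦ k + 1 on the indices 1, …, n.  A reflection ρ of
-- this cycle (ρ s ρ = s⁻¹) differs from t by q = ρ t, a product of at most three transpositions of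
-- points of index ≤ 3.  So for qⱼ = s⁻ʲ q sʲ the elements qⱼ⁻¹ qₖ = s⁻ʲ t sᵏ⁻ʲ t sᵏ lie in G and move
-- only points of index ≤ max (j , k) + 3, whatever a is; products of them are computed once and for
-- all as products of transpositions of indices.
--
-- Two such products are the 3-cycles (F 0, F 1, F 2) and (F 1, F 2, F 3).  Conjugating the second
-- by powers of s gives every (F k, F (k + 1), F (k + 2)), and these generate Alt(Ω).  Conversely t is
-- a product of 2a + 2 transpositions and s = ρ · s⁻ʰ ρ sʰ with 2h = n + 1, so G ≤ Alt(Ω).
--
-- An automorphism of G with r ↦ r⁻¹ and s ↦ s⁻¹ sends t = r s to s t s⁻¹, hence qⱼ⁻¹ qₖ to a conjugate
-- of q_{c−j}⁻¹ q_{c−k}.  It would therefore send A = q₄⁻¹q₃ · q₂⁻¹q₀ to a conjugate of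
-- B = q₃⁻¹q₄ · q₅⁻¹q₇; but Bᵏ = 1 ≠ Aᵏ for k = 3 (i = −1), resp. k = 6 (i = 1).

-- Permutations up to pointwise equality

module _ {X : Set} where

  infix 4 _≋_
  record _≋_ (p q : Perm X) : Set where
    constructor mk≋
    field app : ∀ x → to p x ≡ to q x
  open _≋_ public

  ≋-refl : ∀ {p} → p ≋ p
  ≋-refl = mk≋ λ _ → refl

  ≋-sym : ∀ {p q} → p ≋ q → q ≋ p
  ≋-sym e = mk≋ λ x → sym (app e x)

  ≋-trans : ∀ {p q r} → p ≋ q → q ≋ r → p ≋ r
  ≋-trans e f = mk≋ λ x → trans (app e x) (app f x)

  ⨾-cong : ∀ {p p′ q q′} → p ≋ p′ → q ≋ q′ → (p ⨾ q) ≋ (p′ ⨾ q′)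
  ⨾-cong {p′ = p′} {q} e f = mk≋ λ x → trans (cong (to q) (app e x)) (app f (to p′ x))

  ⁻¹-cong : ∀ {p q} → p ≋ q → (p ⁻¹) ≋ (q ⁻¹)
  ⁻¹-cong {p} {q} e = mk≋ λ x →
    trans (cong (from p) (sym (trans (app e (from q x)) (to∘from q x)))) (from∘to p (from q x))

  ⁻¹-inverseˡ : ∀ p → ((p ⁻¹) ⨾ p) ≋ idP
  ⁻¹-inverseˡ p = mk≋ (to∘from p)

  ^-+ : ∀ p a b → (p ^ (a + b)) ≋ ((p ^ a) ⨾ (p ^ b))
  ^-+ p a zero = mk≋ λ x → cong (λ k → to (p ^ k) x) (ℕ.+-identityʳ a)
  ^-+ p a (suc b) = mk≋ λ x →
    trans (cong (λ k → to (p ^ k) x) (ℕ.+-suc a b)) (cong (to p) (app (^-+ p a b) x))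

  ^-cong : ∀ {p q} k → p ≋ q → (p ^ k) ≋ (q ^ k)
  ^-cong zero e = ≋-refl
  ^-cong (suc k) e = ⨾-cong (^-cong k e) e

  conj : Perm X → Perm X → Perm X
  conj h p = ((h ⁻¹) ⨾ p) ⨾ h

  conj-⨾ : ∀ h p q → conj h (p ⨾ q) ≋ (conj h p ⨾ conj h q)
  conj-⨾ h p q = mk≋ λ x → cong (λ z → to h (to q z)) (sym (from∘to h (to p (from h x))))

  conj-cong : ∀ h {p q} → p ≋ q → conj h p ≋ conj h q
  conj-cong h e = mk≋ λ x → cong (to h) (app e (from h x))

  conj-congˡ : ∀ {h h′} p → h ≋ h′ → conj h p ≋ conj h′ p
  conj-congˡ {h} {h′} p e = mk≋ λ x →
    trans (app e _) (cong (λ z → to h′ (to p z)) (app (⁻¹-cong e) x))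

  conj-conj : ∀ h₁ h₂ p → conj h₂ (conj h₁ p) ≋ conj (h₁ ⨾ h₂) p
  conj-conj h₁ h₂ p = mk≋ λ _ → refl

  conj-⁻¹ : ∀ h p → conj h (p ⁻¹) ≋ (conj h p ⁻¹)
  conj-⁻¹ h p = mk≋ λ _ → refl

  conj-id : ∀ h → conj h idP ≋ idP
  conj-id h = mk≋ (to∘from h)

  conj-^ : ∀ h p k → (conj h p ^ k) ≋ conj h (p ^ k)
  conj-^ h p zero = ≋-sym (conj-id h)
  conj-^ h p (suc k) = ≋-trans (⨾-cong (conj-^ h p k) (≋-refl {conj h p})) (≋-sym (conj-⨾ h (p ^ k) p))

  record IsSubgroup (H : Perm X → Set) : Set where
    field
      ∈-resp-≋ : ∀ {p q} → p ≋ q → H p → H q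
      ∈-⨾      : ∀ {p q} → H p → H q → H (p ⨾ q)
      ∈-⁻¹     : ∀ {p} → H p → H (p ⁻¹)
      ∈-id     : H idP

    ∈-conj : ∀ {h p} → H h → H p → H (conj h p)
    ∈-conj h∈ p∈ = ∈-⨾ (∈-⨾ (∈-⁻¹ h∈) p∈) h∈

    ∈-^ : ∀ {p} k → H p → H (p ^ k)
    ∈-^ zero p∈ = ∈-id
    ∈-^ (suc k) p∈ = ∈-⨾ (∈-^ k p∈) p∈

  ⟨⟩-least : ∀ {H g h p} → IsSubgroup H → H g → H h → Gen g h p → H p
  ⟨⟩-least H-sub g∈ h∈ gen₁ = g∈
  ⟨⟩-least H-sub g∈ h∈ gen₂ = h∈
  ⟨⟩-least H-sub g∈ h∈ unit = IsSubgroup.∈-id H-sub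
  ⟨⟩-least H-sub g∈ h∈ (mul p∈ q∈) =
    IsSubgroup.∈-⨾ H-sub (⟨⟩-least H-sub g∈ h∈ p∈) (⟨⟩-least H-sub g∈ h∈ q∈)
  ⟨⟩-least H-sub g∈ h∈ (inv p∈) = IsSubgroup.∈-⁻¹ H-sub (⟨⟩-least H-sub g∈ h∈ p∈)

  ≋-reflexive : ∀ {p q} → p ≡ q → p ≋ q
  ≋-reflexive refl = ≋-refl

  ≋-setoid : Setoid _ _
  ≋-setoid = record { Carrier = Perm X ; _≈_ = _≋_
                    ; isEquivalence = record { refl = ≋-refl ; sym = ≋-sym ; trans = ≋-trans } }

module ≋-Reasoning {X : Set} = SetoidReasoning (≋-setoid {X})

module _ {X : Set} where

  ^-commute : ∀ (p : Perm X) k → ((p ^ k) ⨾ p) ≋ (p ⨾ (p ^ k))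
  ^-commute p zero = mk≋ λ _ → refl
  ^-commute p (suc k) = ≋-trans (⨾-cong (^-commute p k) (≋-refl {p = p})) (mk≋ λ _ → refl)

  ⁻¹-^ : ∀ (p : Perm X) k → ((p ⁻¹) ^ k) ≋ ((p ^ k) ⁻¹)
  ⁻¹-^ p zero = mk≋ λ _ → refl
  ⁻¹-^ p (suc k) = begin
    ((p ⁻¹) ^ k) ⨾ (p ⁻¹)   ≈⟨ ⨾-cong (⁻¹-^ p k) (≋-refl {p = p ⁻¹}) ⟩
    ((p ^ k) ⁻¹) ⨾ (p ⁻¹)   ≈⟨ mk≋ (λ _ → refl) ⟩
    (p ⨾ (p ^ k)) ⁻¹        ≈⟨ ⁻¹-cong (≋-sym (^-commute p k)) ⟩
    (p ^ suc k) ⁻¹          ∎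
    where open ≋-Reasoning

  hasOrder-2 : ∀ {p : Perm X} → (p ^ 2) ≋ idP → ¬ (p ≋ idP) → HasOrder p 2
  hasOrder-2 {p} p²≋id p≉id = s≤s z≤n , app p²≋id , λ where
    1 _ _ p¹≈id → p≉id (mk≋ p¹≈id)
    (suc (suc k)) _ (s≤s (s≤s ()))

  hasOrder-4 : ∀ {p : Perm X} → (p ^ 4) ≋ idP → ¬ ((p ^ 2) ≋ idP) → HasOrder p 4
  hasOrder-4 {p} p⁴≋id p²≉id = s≤s z≤n , app p⁴≋id , λ where
    1 _ _ p¹≈id → p²≉id (mk≋ λ x → trans (cong (to p) (p¹≈id x)) (p¹≈id x))
    2 _ _ p²≈id → p²≉id (mk≋ p²≈id)
    3 _ _ p³≈id → p²≉id (mk≋ λ x → let p≈id = λ z → trans (sym (cong (to p) (p³≈id z))) (app p⁴≋id z)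
                                    in trans (cong (to p) (p≈id x)) (p≈id x))
    (suc (suc (suc (suc k)))) _ (s≤s (s≤s (s≤s (s≤s ()))))

  idempotent⇒id : ∀ {p : Perm X} → (p ⨾ p) ≋ p → p ≋ idP
  idempotent⇒id {p} pp≋p = mk≋ λ x → trans (sym (from∘to p (to p x))) (trans (cong (from p) (app pp≋p x)) (from∘to p x))

  inverse-unique : ∀ {p q : Perm X} → (q ⨾ p) ≋ idP → q ≋ (p ⁻¹)
  inverse-unique {p} {q} qp≋id = mk≋ λ x → trans (sym (from∘to p (to q x))) (cong (from p) (app qp≋id x))

  ^-⨾-^⁻¹ : ∀ (p : Perm X) a c → ((p ^ a) ⨾ ((p ^ (a + c)) ⁻¹)) ≋ ((p ^ c) ⁻¹)
  ^-⨾-^⁻¹ p a c = mk≋ λ x → begin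
    from (p ^ (a + c)) (to (p ^ a) x)            ≡⟨ cong (λ k → from (p ^ k) (to (p ^ a) x)) (ℕ.+-comm a c) ⟩
    from (p ^ (c + a)) (to (p ^ a) x)            ≡⟨ app (⁻¹-cong (^-+ p c a)) (to (p ^ a) x) ⟩
    from (p ^ c) (from (p ^ a) (to (p ^ a) x))   ≡⟨ cong (from (p ^ c)) (from∘to (p ^ a) x) ⟩
    from (p ^ c) x                               ∎
    where open ≡-Reasoning

-- Even permutations

module _ {X : Set} where

  product-++ : (ts us : List (Perm X)) → product (ts ++ us) ≋ (product ts ⨾ product us)
  product-++ [] us = mk≋ λ _ → refl
  product-++ (t ∷ ts) us = mk≋ λ x → app (product-++ ts us) (to t x)

  product-conj : ∀ h (ts : List (Perm X)) → conj h (product ts) ≋ product (map (conj h) ts)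
  product-conj h [] = conj-id h
  product-conj h (t ∷ ts) = ≋-trans (conj-⨾ h t (product ts)) (⨾-cong (≋-refl {p = conj h t}) (product-conj h ts))

  invert : List (Perm X) → List (Perm X)
  invert [] = []
  invert (t ∷ ts) = invert ts ++ [ t ⁻¹ ]

  length-invert : ∀ ts → length (invert ts) ≡ length ts
  length-invert [] = refl
  length-invert (t ∷ ts) = trans (length-++ (invert ts)) (trans (ℕ.+-comm _ 1) (cong suc (length-invert ts)))

  product-invert : ∀ ts → product (invert ts) ≋ (product ts ⁻¹)
  product-invert [] = ≋-refl
  product-invert (t ∷ ts) = mk≋ λ x →
    trans (app (product-++ (invert ts) [ t ⁻¹ ]) x) (cong (from t) (app (product-invert ts) x))

  transposition-⁻¹ : ∀ (p : Perm X) → IsTransposition p → IsTransposition (p ⁻¹)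
  transposition-⁻¹ p (x , y , x≢y , px , py , pz) =
    x , y , x≢y , back py , back px , λ z z≢x z≢y → back (pz z z≢x z≢y)
    where
    back : ∀ {u v} → to p u ≡ v → from p v ≡ u
    back refl = from∘to p _

  transposition-conj : ∀ h (p : Perm X) → IsTransposition p → IsTransposition (conj h p)
  transposition-conj h p (x , y , x≢y , px , py , pz) =
    to h x , to h y , (λ e → x≢y (inj e)) , image px , image py , fixed
    where
    inj : ∀ {u v} → to h u ≡ to h v → u ≡ v
    inj {u} {v} e = trans (sym (from∘to h u)) (trans (cong (from h) e) (from∘to h v))
    image : ∀ {u v} → to p u ≡ v → to h (to p (from h (to h u))) ≡ to h v
    image {u} pu = cong (to h) (trans (cong (to p) (from∘to h u)) pu)
    fixed : ∀ z → z ≢ to h x → z ≢ to h y → to h (to p (from h z)) ≡ z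
    fixed z z≢hx z≢hy = trans (cong (to h) (pz (from h z) (avoid z≢hx) (avoid z≢hy))) (to∘from h z)
      where
      avoid : ∀ {w} → z ≢ to h w → from h z ≢ w
      avoid z≢hw refl = z≢hw (sym (to∘from h z))

  transpositions-invert : ∀ {ts} → All IsTransposition ts → All IsTransposition (invert ts)
  transpositions-invert [] = []
  transpositions-invert {t ∷ ts} (τ ∷ τs) = ++⁺ (transpositions-invert τs) (transposition-⁻¹ t τ ∷ [])

  transpositions-conj : ∀ h {ts} → All IsTransposition ts → All IsTransposition (map (conj h) ts)
  transpositions-conj h [] = []
  transpositions-conj h {t ∷ ts} (τ ∷ τs) = transposition-conj h t τ ∷ transpositions-conj h τs

  isEven-isSubgroup : IsSubgroup (IsEven {X})
  isEven-isSubgroup = record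
    { ∈-resp-≋ = λ { e (ts , τs , 2∣ , ts≈) → ts , τs , 2∣ , λ x → trans (ts≈ x) (app e x) }
    ; ∈-⨾ = λ { {p} {q} (ts , τs , 2∣ , ts≈) (us , υs , 2∣′ , us≈) →
                ts ++ us , ++⁺ τs υs , subst (2 ∣_) (sym (length-++ ts)) (∣m∣n⇒∣m+n 2∣ 2∣′)
                , app (≋-trans (product-++ ts us) (⨾-cong {p = product ts} {p′ = p} {q = product us} {q′ = q} (mk≋ ts≈) (mk≋ us≈))) }
    ; ∈-⁻¹ = λ { {p} (ts , τs , 2∣ , ts≈) →
                invert ts , transpositions-invert τs , subst (2 ∣_) (sym (length-invert ts)) 2∣
                , app (≋-trans (product-invert ts) (⁻¹-cong {p = product ts} {q = p} (mk≋ ts≈))) }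
    ; ∈-id = [] , [] , divides 0 refl , λ _ → refl
    }

  -- Each transposition of p is used twice, whatever the parity of p.
  isEven-⨾-conj : ∀ {p} h ts → All IsTransposition ts → product ts ≋ p → IsEven (p ⨾ conj h p)
  isEven-⨾-conj {p} h ts τs ts≋p =
    ts ++ map (conj h) ts , ++⁺ τs (transpositions-conj h τs) ,
    divides (length ts) (begin
      length (ts ++ map (conj h) ts)   ≡⟨ length-++ ts ⟩
      length ts + length (map (conj h) ts) ≡⟨ cong (length ts +_) (length-map (conj h) ts) ⟩
      length ts + length ts            ≡⟨ cong (length ts +_) (sym (ℕ.+-identityʳ _)) ⟩
      2 * length ts                    ≡⟨ ℕ.*-comm 2 (length ts) ⟩
      length ts * 2                    ∎) ,
    app (≋-trans (product-++ ts (map (conj h) ts))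
          (⨾-cong ts≋p (≋-trans (≋-sym (product-conj h ts)) (conj-cong h ts≋p))))
    where open ≡-Reasoning

-- Transpositions and 3-cycles

module Transpositions {X : Set} (_≟_ : DecidableEquality X) where

  swapᶠ : X → X → X → X
  swapᶠ x y z with z ≟ x | z ≟ y
  ... | yes _ | _     = y
  ... | no _  | yes _ = x
  ... | no _  | no _  = z

  swapᶠ-l : ∀ x y → swapᶠ x y x ≡ y
  swapᶠ-l x y with x ≟ x
  ... | yes _ = refl
  ... | no x≢x = ⊥-elim (x≢x refl)

  swapᶠ-r : ∀ x y → swapᶠ x y y ≡ x
  swapᶠ-r x y with y ≟ x | y ≟ y
  ... | yes y≡x | _ = y≡x
  ... | no _ | yes _ = refl
  ... | no _ | no y≢y = ⊥-elim (y≢y refl)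

  swapᶠ-o : ∀ {x y z} → z ≢ x → z ≢ y → swapᶠ x y z ≡ z
  swapᶠ-o {x} {y} {z} z≢x z≢y with z ≟ x | z ≟ y
  ... | yes z≡x | _ = ⊥-elim (z≢x z≡x)
  ... | no _ | yes z≡y = ⊥-elim (z≢y z≡y)
  ... | no _ | no _ = refl

  swapᶠ-involutive : ∀ x y z → swapᶠ x y (swapᶠ x y z) ≡ z
  swapᶠ-involutive x y z with z ≟ x | z ≟ y
  ... | yes refl | _ = swapᶠ-r z y
  ... | no _ | yes refl = swapᶠ-l x z
  ... | no z≢x | no z≢y = swapᶠ-o z≢x z≢y

  swap : X → X → Perm X
  swap x y = perm (swapᶠ x y) (swapᶠ x y) (swapᶠ-involutive x y) (swapᶠ-involutive x y)

  swap-isTransposition : ∀ x y → x ≢ y → IsTransposition (swap x y)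
  swap-isTransposition x y x≢y = x , y , x≢y , swapᶠ-l x y , swapᶠ-r x y , λ _ → swapᶠ-o

  transposition≋swap : ∀ p {x y} → to p x ≡ y → to p y ≡ x →
                       (∀ z → z ≢ x → z ≢ y → to p z ≡ z) → p ≋ swap x y
  transposition≋swap p {x} {y} px py pz = mk≋ λ z → go z (z ≟ x) (z ≟ y)
    where
    go : ∀ z → Dec (z ≡ x) → Dec (z ≡ y) → to p z ≡ swapᶠ x y z
    go z (yes refl) _ = trans px (sym (swapᶠ-l z y))
    go z (no _) (yes refl) = trans py (sym (swapᶠ-r x z))
    go z (no z≢x) (no z≢y) = trans (pz z z≢x z≢y) (sym (swapᶠ-o z≢x z≢y))

  swap-sym : ∀ x y → swap x y ≋ swap y x
  swap-sym x y = transposition≋swap (swap x y) (swapᶠ-r x y) (swapᶠ-l x y) λ z z≢y z≢x → swapᶠ-o z≢x z≢y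

  swap-conj : ∀ h x y → conj h (swap x y) ≋ swap (to h x) (to h y)
  swap-conj h x y = transposition≋swap (conj h (swap x y)) (image (swapᶠ-l x y)) (image (swapᶠ-r x y)) fixed
    where
    image : ∀ {u v} → swapᶠ x y u ≡ v → to h (swapᶠ x y (from h (to h u))) ≡ to h v
    image {u} e = cong (to h) (trans (cong (swapᶠ x y) (from∘to h u)) e)
    fixed : ∀ z → z ≢ to h x → z ≢ to h y → to h (swapᶠ x y (from h z)) ≡ z
    fixed z z≢hx z≢hy = trans (cong (to h) (swapᶠ-o (avoid z≢hx) (avoid z≢hy))) (to∘from h z)
      where
      avoid : ∀ {w} → z ≢ to h w → from h z ≢ w
      avoid z≢hw refl = z≢hw (sym (to∘from h z))

  cycle₃ : X → X → X → Perm X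
  cycle₃ x y z = swap x y ⨾ swap x z

  Distinct : X → X → X → Set
  Distinct x y z = x ≢ y × y ≢ z × x ≢ z

  rotate : ∀ {x y z} → Distinct x y z → Distinct y z x
  rotate (x≢y , y≢z , x≢z) = y≢z , ≢-sym x≢z , ≢-sym x≢y

  cycle₃-conj : ∀ h x y z → conj h (cycle₃ x y z) ≋ cycle₃ (to h x) (to h y) (to h z)
  cycle₃-conj h x y z = ≋-trans (conj-⨾ h (swap x y) (swap x z)) (⨾-cong (swap-conj h x y) (swap-conj h x z))

  cycle₃-x : ∀ {x y z} → Distinct x y z → to (cycle₃ x y z) x ≡ y
  cycle₃-x {x} {y} {z} (x≢y , y≢z , _) =
    trans (cong (swapᶠ x z) (swapᶠ-l x y)) (swapᶠ-o (≢-sym x≢y) y≢z)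

  cycle₃-y : ∀ x y z → to (cycle₃ x y z) y ≡ z
  cycle₃-y x y z = trans (cong (swapᶠ x z) (swapᶠ-r x y)) (swapᶠ-l x z)

  cycle₃-z : ∀ {x y z} → Distinct x y z → to (cycle₃ x y z) z ≡ x
  cycle₃-z {x} {y} {z} (_ , y≢z , x≢z) =
    trans (cong (swapᶠ x z) (swapᶠ-o (≢-sym x≢z) (≢-sym y≢z))) (swapᶠ-r x z)

  cycle₃-fixes : ∀ {x y z w} → w ≢ x → w ≢ y → w ≢ z → to (cycle₃ x y z) w ≡ w
  cycle₃-fixes {x} {y} {z} w≢x w≢y w≢z = trans (cong (swapᶠ x z) (swapᶠ-o w≢x w≢y)) (swapᶠ-o w≢x w≢z)

  module _ {H : Perm X → Set} (H-sub : IsSubgroup H) where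
    open IsSubgroup H-sub

    -- The images are given by equations, so that two cycle₃ terms never have to be unified.
    ∈-cycle₃-conj : ∀ {h x y z x′ y′ z′} → H h → to h x ≡ x′ → to h y ≡ y′ → to h z ≡ z′ →
                    H (cycle₃ x y z) → H (cycle₃ x′ y′ z′)
    ∈-cycle₃-conj {h} {x} {y} {z} h∈ refl refl refl c∈ = ∈-resp-≋ (cycle₃-conj h x y z) (∈-conj h∈ c∈)

    ∈-cycle₃-inverse : ∀ {x y z} → H (cycle₃ x y z) → H (cycle₃ x z y)
    ∈-cycle₃-inverse c∈ = ∈-resp-≋ (mk≋ λ _ → refl) (∈-⁻¹ c∈)

    ∈-cycle₃-rotate : ∀ {x y z} → Distinct x y z → H (cycle₃ x y z) → H (cycle₃ y z x)
    ∈-cycle₃-rotate {x} {y} {z} d c∈ =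
      ∈-cycle₃-conj c∈ (cycle₃-x d) (cycle₃-y x y z) (cycle₃-z d) c∈

    ∈-cycle₃-unrotate : ∀ {x y z} → Distinct x y z → H (cycle₃ y z x) → H (cycle₃ x y z)
    ∈-cycle₃-unrotate d c∈ = ∈-cycle₃-rotate (rotate (rotate d)) (∈-cycle₃-rotate (rotate d) c∈)

    Has3Cycles : Set
    Has3Cycles = ∀ x y z → Distinct x y z → H (cycle₃ x y z)

    module Fan {x₀ x₁ : X} (x₀≢x₁ : x₀ ≢ x₁) (fan : ∀ z → z ≢ x₀ → z ≢ x₁ → H (cycle₃ x₀ x₁ z)) where

      through-x₁ : ∀ b c → b ≢ c → b ≢ x₀ → b ≢ x₁ → c ≢ x₀ → c ≢ x₁ → H (cycle₃ x₁ b c)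
      through-x₁ b c b≢c b≢x₀ b≢x₁ c≢x₀ c≢x₁ =
        ∈-cycle₃-conj (fan b b≢x₀ b≢x₁) (cycle₃-x (x₀≢x₁ , ≢-sym b≢x₁ , ≢-sym b≢x₀)) (cycle₃-y x₀ x₁ b)
                      (cycle₃-fixes c≢x₀ c≢x₁ (≢-sym b≢c)) (fan c c≢x₀ c≢x₁)

      through-x₀ : ∀ b c → b ≢ c → b ≢ x₀ → b ≢ x₁ → c ≢ x₀ → c ≢ x₁ → H (cycle₃ x₀ b c)
      through-x₀ b c b≢c b≢x₀ b≢x₁ c≢x₀ c≢x₁ =
        ∈-cycle₃-rotate (c≢x₀ , ≢-sym b≢x₀ , ≢-sym b≢c)
          (∈-cycle₃-conj (∈-cycle₃-inverse (fan c c≢x₀ c≢x₁)) (cycle₃-x d) (cycle₃-z d)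
                         (cycle₃-fixes b≢x₀ b≢c b≢x₁) (fan b b≢x₀ b≢x₁))
        where
        d : Distinct x₀ c x₁
        d = ≢-sym c≢x₀ , c≢x₁ , x₀≢x₁

      avoiding-x₀x₁ : ∀ a b c → Distinct a b c → a ≢ x₀ → a ≢ x₁ → b ≢ x₀ → b ≢ x₁ → c ≢ x₀ → c ≢ x₁ →
                      H (cycle₃ a b c)
      avoiding-x₀x₁ a b c (a≢b , b≢c , a≢c) a≢x₀ a≢x₁ b≢x₀ b≢x₁ c≢x₀ c≢x₁ =
        ∈-cycle₃-conj (∈-cycle₃-inverse (fan a a≢x₀ a≢x₁)) (cycle₃-x d) (cycle₃-fixes b≢x₀ (≢-sym a≢b) b≢x₁)
                      (cycle₃-fixes c≢x₀ (≢-sym a≢c) c≢x₁) (through-x₀ b c b≢c b≢x₀ b≢x₁ c≢x₀ c≢x₁)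
        where
        d : Distinct x₀ a x₁
        d = ≢-sym a≢x₀ , a≢x₁ , x₀≢x₁

      x₀-first : ∀ b c → Distinct x₀ b c → H (cycle₃ x₀ b c)
      x₀-first b c (x₀≢b , b≢c , x₀≢c) with b ≟ x₁ | c ≟ x₁
      ... | yes refl | _ = fan c (≢-sym x₀≢c) (≢-sym b≢c)
      ... | no _ | yes refl = ∈-cycle₃-inverse (fan b (≢-sym x₀≢b) b≢c)
      ... | no b≢x₁ | no c≢x₁ = through-x₀ b c b≢c (≢-sym x₀≢b) b≢x₁ (≢-sym x₀≢c) c≢x₁

      x₁-first : ∀ b c → Distinct x₁ b c → b ≢ x₀ → c ≢ x₀ → H (cycle₃ x₁ b c)
      x₁-first b c (x₁≢b , b≢c , x₁≢c) b≢x₀ c≢x₀ = through-x₁ b c b≢c b≢x₀ (≢-sym x₁≢b) c≢x₀ (≢-sym x₁≢c)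

      has3Cycles : Has3Cycles
      has3Cycles a b c d with a ≟ x₀ | b ≟ x₀ | c ≟ x₀
      ... | yes refl | _ | _ = x₀-first b c d
      ... | no _ | yes refl | _ = ∈-cycle₃-unrotate d (x₀-first c a (rotate d))
      ... | no _ | no _ | yes refl = ∈-cycle₃-rotate (rotate (rotate d)) (x₀-first a b (rotate (rotate d)))
      ... | no a≢x₀ | no b≢x₀ | no c≢x₀ with a ≟ x₁ | b ≟ x₁ | c ≟ x₁
      ...   | yes refl | _ | _ = x₁-first b c d b≢x₀ c≢x₀
      ...   | no _ | yes refl | _ = ∈-cycle₃-unrotate d (x₁-first c a (rotate d) c≢x₀ a≢x₀)
      ...   | no _ | no _ | yes refl = ∈-cycle₃-rotate (rotate (rotate d)) (x₁-first a b (rotate (rotate d)) a≢x₀ b≢x₀)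
      ...   | no a≢x₁ | no b≢x₁ | no c≢x₁ = avoiding-x₀x₁ a b c d a≢x₀ a≢x₁ b≢x₀ b≢x₁ c≢x₀ c≢x₁

    swap-pair∈ : Has3Cycles → ∀ x y z w → x ≢ y → z ≢ w → H (swap x y ⨾ swap z w)
    swap-pair∈ C x y z w x≢y z≢w with x ≟ z
    ... | yes refl with y ≟ w
    ...   | yes refl = ∈-resp-≋ (mk≋ λ v → sym (swapᶠ-involutive x y v)) ∈-id
    ...   | no y≢w = C x y w (x≢y , y≢w , z≢w)
    swap-pair∈ C x y z w x≢y z≢w | no x≢z with x ≟ w
    ...   | yes refl with y ≟ z
    ...     | yes refl = ∈-resp-≋ (mk≋ λ v → sym (trans (app (swap-sym y x) (swapᶠ x y v)) (swapᶠ-involutive x y v))) ∈-id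
    ...     | no y≢z = ∈-resp-≋ (⨾-cong (≋-refl {p = swap x y}) (swap-sym x z)) (C x y z (x≢y , y≢z , x≢z))
    swap-pair∈ C x y z w x≢y z≢w | no x≢z | no x≢w with y ≟ z
    ...     | yes refl = ∈-resp-≋ (⨾-cong (swap-sym y x) (≋-refl {p = swap y w})) (C y x w (≢-sym x≢y , x≢w , z≢w))
    ...     | no y≢z with y ≟ w
    ...       | yes refl = ∈-resp-≋ (⨾-cong (swap-sym y x) (swap-sym y z)) (C y x z (≢-sym x≢y , x≢z , ≢-sym z≢w))
    ...       | no y≢w = ∈-resp-≋ (mk≋ (λ v → cong (swapᶠ z w) (trans (cong (swapᶠ z x) (app (swap-sym x z) (swapᶠ x y v))) (swapᶠ-involutive z x (swapᶠ x y v)))))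
                           (∈-⨾ (C x y z (x≢y , y≢z , x≢z)) (C z x w (≢-sym x≢z , x≢w , z≢w)))

    3cycles⇒even : Has3Cycles → ∀ {p} → IsEven p → H p
    3cycles⇒even C (ts , τs , 2∣ , ts≈p) = ∈-resp-≋ (mk≋ ts≈p) (go ts τs 2∣)
      where
      go : ∀ ts → All IsTransposition ts → 2 ∣ length ts → H (product ts)
      go [] [] _ = ∈-id
      go (_ ∷ []) (_ ∷ []) 2∣1 with () ← ∣1⇒≡1 2∣1
      go (τ₁ ∷ τ₂ ∷ ts) ((x , y , x≢y , τ₁x , τ₁y , τ₁z) ∷ (z , w , z≢w , τ₂z , τ₂w , τ₂v) ∷ τs) 2∣ =
        ∈-resp-≋ (mk≋ λ _ → refl) (∈-⨾ (∈-resp-≋ (≋-sym (⨾-cong (transposition≋swap τ₁ τ₁x τ₁y τ₁z) (transposition≋swap τ₂ τ₂z τ₂w τ₂v)))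
                      (swap-pair∈ C x y z w x≢y z≢w))
            (go ts τs (∣m+n∣m⇒∣n 2∣ (∣-refl {2}))))

    module _ (F : ℕ → X) {n : ℕ} (F-injective : ∀ {j k} → j ≤ n → k ≤ n → F j ≡ F k → j ≡ k) where

      private
        apart : ∀ {a b} → a < b → b ≤ n → F a ≢ F b
        apart a<b b≤n e = ℕ.<⇒≢ a<b (F-injective (ℕ.≤-trans (ℕ.<⇒≤ a<b) b≤n) b≤n e)

        1<2+ : ∀ {b} → 1 < suc (suc b)
        1<2+ = s<s z<s

      windows⇒fan : 4 ≤ n → (∀ k → H (cycle₃ (F k) (F (suc k)) (F (suc (suc k))))) →
                    ∀ k → 2 ≤ k → k ≤ n → H (cycle₃ (F 0) (F 1) (F k))
      windows⇒fan 4≤n W 1 (s≤s ()) _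
      windows⇒fan 4≤n W 2 _ _ = W 0
      windows⇒fan 4≤n W 3 _ _ =
        ∈-cycle₃-conj (W 2) (cycle₃-fixes (apart z<s 2≤n) (apart z<s 3≤n) (apart z<s 4≤n))
                      (cycle₃-fixes (apart 1<2+ 2≤n) (apart 1<2+ 3≤n) (apart 1<2+ 4≤n))
                      (cycle₃-x (apart (s<s 1<2+) 3≤n , apart (s<s (s<s 1<2+)) 4≤n , apart (s<s 1<2+) 4≤n))
                      (W 0)
        where
        3≤n : 3 ≤ n
        3≤n = ℕ.≤-trans (ℕ.n≤1+n 3) 4≤n
        2≤n : 2 ≤ n
        2≤n = ℕ.≤-trans (ℕ.n≤1+n 2) 3≤n
      windows⇒fan 4≤n W (suc (suc (suc (suc j)))) _ 4+j≤n =
        ∈-cycle₃-conj (W (2 + j)) (cycle₃-fixes (apart z<s 2+j≤n) (apart z<s 3+j≤n) (apart z<s 4+j≤n))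
                      (cycle₃-fixes (apart 1<2+ 2+j≤n) (apart 1<2+ 3+j≤n) (apart 1<2+ 4+j≤n))
                      (cycle₃-y (F (2 + j)) (F (3 + j)) (F (4 + j)))
                      (windows⇒fan 4≤n W (suc (suc (suc j))) (s≤s (s≤s z≤n)) 3+j≤n)
        where
        3+j≤n : 3 + j ≤ n
        3+j≤n = ℕ.≤-trans (ℕ.n≤1+n _) 4+j≤n
        2+j≤n : 2 + j ≤ n
        2+j≤n = ℕ.≤-trans (ℕ.n≤1+n _) 3+j≤n

-- Lists of transpositions of indices

IndexList : Set
IndexList = List (ℕ × ℕ)

swapℕ : ℕ → ℕ → ℕ → ℕ
swapℕ a b j with j ℕ.≟ a | j ℕ.≟ b
... | yes _ | _     = b
... | no _  | yes _ = a
... | no _  | no _  = j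

swapsℕ : IndexList → ℕ → ℕ
swapsℕ [] j = j
swapsℕ ((a , b) ∷ L) j = swapsℕ L (swapℕ a b j)

Bounded : ℕ → IndexList → Set
Bounded K = All λ (a , b) → a ≤ K × b ≤ K

bounded? : ∀ K L → Dec (Bounded K L)
bounded? K = all? λ (a , b) → (a ≤? K) ×-dec (b ≤? K)

swapsℕ-beyond : ∀ {K L j} → Bounded K L → K < j → swapsℕ L j ≡ j
swapsℕ-beyond [] K<j = refl
swapsℕ-beyond {K} {(a , b) ∷ L} {j} ((a≤K , b≤K) ∷ B) K<j with j ℕ.≟ a | j ℕ.≟ b
... | yes refl | _ = ⊥-elim (ℕ.<-irrefl refl (ℕ.≤-<-trans a≤K K<j))
... | no _ | yes refl = ⊥-elim (ℕ.<-irrefl refl (ℕ.≤-<-trans b≤K K<j))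
... | no _ | no _ = swapsℕ-beyond B K<j

SameOn : ℕ → IndexList → IndexList → Set
SameOn K L L′ = ∀ (j : Fin (suc K)) → swapsℕ L (toℕ j) ≡ swapsℕ L′ (toℕ j)

record Agree (K : ℕ) (L L′ : IndexList) : Set where
  field
    bounded₁ : Bounded K L
    bounded₂ : Bounded K L′
    same     : ∀ j → swapsℕ L j ≡ swapsℕ L′ j

agree : ∀ {K L L′} → Bounded K L → Bounded K L′ → SameOn K L L′ → Agree K L L′
agree {K} {L} {L′} B B′ S = record { bounded₁ = B ; bounded₂ = B′ ; same = same }
  where
  same : ∀ j → swapsℕ L j ≡ swapsℕ L′ j
  same j with j ≤? K
  ... | yes j≤K = subst (λ i → swapsℕ L i ≡ swapsℕ L′ i) (Fin.toℕ-fromℕ< (s≤s j≤K)) (S (fromℕ< (s≤s j≤K)))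
  ... | no j≰K = trans (swapsℕ-beyond B (ℕ.≰⇒> j≰K)) (sym (swapsℕ-beyond B′ (ℕ.≰⇒> j≰K)))

sameOn? : ∀ K L L′ → Dec (SameOn K L L′)
sameOn? K L L′ = Fin.all? λ j → swapsℕ L (toℕ j) ℕ.≟ swapsℕ L′ (toℕ j)

agree-by-evaluation : ∀ {K L L′} {_ : True (bounded? K L)} {_ : True (bounded? K L′)}
                      {_ : True (sameOn? K L L′)} → Agree K L L′
agree-by-evaluation {K} {L} {L′} {B} {B′} {S} =
  agree (toWitness {a? = bounded? K L} B) (toWitness {a? = bounded? K L′} B′) (toWitness {a? = sameOn? K L L′} S)

-- The index of sʲ x in terms of that of x (index 0 is β′, fixed by s); indices are not reduced mod n.
shiftIndex : ℕ → ℕ → ℕ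
shiftIndex j zero = zero
shiftIndex j (suc k) = suc (k + j)

shift : ℕ → IndexList → IndexList
shift j = map (Prod.map (shiftIndex j) (shiftIndex j))

-- (j , k) stands for qⱼ⁻¹ qₖ, where qⱼ = s⁻ʲ q sʲ and L realises q.
pairIndices : IndexList → ℕ × ℕ → IndexList
pairIndices L (j , k) = reverse (shift j L) ++ shift k L

wordIndices : IndexList → List (ℕ × ℕ) → IndexList
wordIndices L = concatMap (pairIndices L)

record MovesZero (K : ℕ) (L : IndexList) : Set where
  field
    bounded : Bounded K L
    moves   : swapsℕ L 0 ≢ 0

moves-by-evaluation : ∀ {K L} {_ : True (bounded? K L)} {_ : False (swapsℕ L 0 ℕ.≟ 0)} → MovesZero K L
moves-by-evaluation {K} {L} {B} {M} =
  record { bounded = toWitness {a? = bounded? K L} B ; moves = toWitnessFalse {a? = swapsℕ L 0 ℕ.≟ 0} M }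

module Realisation {X : Set} (_≟_ : DecidableEquality X) (F : ℕ → X) (n : ℕ)
                   (F-injective : ∀ {j k} → j ≤ n → k ≤ n → F j ≡ F k → j ≡ k)
                   (index : X → ℕ) (index≤n : ∀ x → index x ≤ n) (F-index : ∀ x → F (index x) ≡ x) where
  open Transpositions _≟_

  transposition : ℕ × ℕ → Perm X
  transposition (a , b) = swap (F a) (F b)

  ⟦_⟧ : IndexList → Perm X
  ⟦ L ⟧ = product (map transposition L)

  Acts : Perm X → (ℕ → ℕ) → Set
  Acts p π = ∀ j → j ≤ n → to p (F j) ≡ F (π j)

  swap-acts : ∀ {a b} → a ≤ n → b ≤ n → Acts (swap (F a) (F b)) (swapℕ a b)
  swap-acts {a} {b} a≤n b≤n j j≤n with j ℕ.≟ a | j ℕ.≟ b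
  ... | yes refl | _ = swapᶠ-l (F j) (F b)
  ... | no _ | yes refl = swapᶠ-r (F a) (F j)
  ... | no j≢a | no j≢b = swapᶠ-o (λ e → j≢a (F-injective j≤n a≤n e)) (λ e → j≢b (F-injective j≤n b≤n e))

  swapℕ≤n : ∀ {a b j} → a ≤ n → b ≤ n → j ≤ n → swapℕ a b j ≤ n
  swapℕ≤n {a} {b} {j} a≤n b≤n j≤n with j ℕ.≟ a | j ℕ.≟ b
  ... | yes _ | _ = b≤n
  ... | no _ | yes _ = a≤n
  ... | no _ | no _ = j≤n

  ⟦⟧-acts : ∀ {L} → Bounded n L → Acts ⟦ L ⟧ (swapsℕ L)
  ⟦⟧-acts [] j j≤n = refl
  ⟦⟧-acts {(a , b) ∷ L} ((a≤n , b≤n) ∷ B) j j≤n =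
    trans (cong (to ⟦ L ⟧) (swap-acts a≤n b≤n j j≤n)) (⟦⟧-acts B (swapℕ a b j) (swapℕ≤n a≤n b≤n j≤n))

  acts⇒≋ : ∀ {p q π σ} → Acts p π → Acts q σ → (∀ j → π j ≡ σ j) → p ≋ q
  acts⇒≋ {p} {q} {π} {σ} p-acts q-acts π≗σ = mk≋ λ x → begin
    to p x                 ≡⟨ cong (to p) (sym (F-index x)) ⟩
    to p (F (index x))     ≡⟨ p-acts (index x) (index≤n x) ⟩
    F (π (index x))        ≡⟨ cong F (π≗σ (index x)) ⟩
    F (σ (index x))        ≡⟨ q-acts (index x) (index≤n x) ⟨
    to q (F (index x))     ≡⟨ cong (to q) (F-index x) ⟩
    to q x                 ∎
    where open ≡-Reasoning

  bounded-≤ : ∀ {K L} → K ≤ n → Bounded K L → Bounded n L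
  bounded-≤ K≤n = All.map (Prod.map (λ a≤K → ℕ.≤-trans a≤K K≤n) (λ b≤K → ℕ.≤-trans b≤K K≤n))

  ⟦⟧-agree : ∀ {K L L′} → K ≤ n → Agree K L L′ → ⟦ L ⟧ ≋ ⟦ L′ ⟧
  ⟦⟧-agree K≤n A = acts⇒≋ (⟦⟧-acts (bounded-≤ K≤n bounded₁)) (⟦⟧-acts (bounded-≤ K≤n bounded₂)) same
    where open Agree A

  swapsℕ≤n : ∀ {L j} → Bounded n L → j ≤ n → swapsℕ L j ≤ n
  swapsℕ≤n [] j≤n = j≤n
  swapsℕ≤n ((a≤n , b≤n) ∷ B) j≤n = swapsℕ≤n B (swapℕ≤n a≤n b≤n j≤n)

  ⟦⟧-moves : ∀ {K L j} → K ≤ n → Bounded K L → j ≤ n → swapsℕ L j ≢ j → ¬ (⟦ L ⟧ ≋ idP)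
  ⟦⟧-moves {K} {L} {j} K≤n B j≤n moves L≋id =
    moves (F-injective (swapsℕ≤n Bₙ j≤n) j≤n (trans (sym (⟦⟧-acts Bₙ j j≤n)) (app L≋id (F j))))
    where Bₙ = bounded-≤ K≤n B

  ⟦⟧-++ : ∀ L L′ → ⟦ L ++ L′ ⟧ ≋ (⟦ L ⟧ ⨾ ⟦ L′ ⟧)
  ⟦⟧-++ L L′ = ≋-trans (≋-reflexive (cong product (map-++ _ L L′))) (product-++ (map _ L) (map _ L′))

  ⟦⟧-singleton : ∀ a b → ⟦ [ a , b ] ⟧ ≋ swap (F a) (F b)
  ⟦⟧-singleton a b = mk≋ λ _ → refl

  ⟦⟧-cycle₃ : ∀ a b c → ⟦ (a , b) ∷ (a , c) ∷ [] ⟧ ≋ cycle₃ (F a) (F b) (F c)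
  ⟦⟧-cycle₃ a b c = mk≋ λ _ → refl

  ⟦⟧-reverse : ∀ L → ⟦ reverse L ⟧ ≋ (⟦ L ⟧ ⁻¹)
  ⟦⟧-reverse [] = ≋-refl
  ⟦⟧-reverse ((a , b) ∷ L) = begin
    ⟦ reverse ((a , b) ∷ L) ⟧          ≈⟨ ≋-reflexive (cong ⟦_⟧ (unfold-reverse (a , b) L)) ⟩
    ⟦ reverse L ∷ʳ (a , b) ⟧           ≈⟨ ⟦⟧-++ (reverse L) [ a , b ] ⟩
    ⟦ reverse L ⟧ ⨾ ⟦ [ a , b ] ⟧      ≈⟨ ⨾-cong (⟦⟧-reverse L) (⟦⟧-singleton a b) ⟩
    (⟦ L ⟧ ⁻¹) ⨾ swap (F a) (F b)      ≈⟨ mk≋ (λ _ → refl) ⟩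
    ⟦ (a , b) ∷ L ⟧ ⁻¹                 ∎
    where open ≋-Reasoning

  ⟦⟧-conj : ∀ h f → (∀ j → to h (F j) ≡ F (f j)) → ∀ L → conj h ⟦ L ⟧ ≋ ⟦ map (Prod.map f f) L ⟧
  ⟦⟧-conj h f hF [] = conj-id h
  ⟦⟧-conj h f hF ((a , b) ∷ L) =
    ≋-trans (conj-⨾ h (swap (F a) (F b)) ⟦ L ⟧)
            (⨾-cong (≋-trans (swap-conj h (F a) (F b)) (≋-reflexive (cong₂ swap (hF a) (hF b)))) (⟦⟧-conj h f hF L))

-- The points of Ω and the n-cycle of s

nxt-toℕ : ∀ {m} {j k : Fin m} → nxt j ≡ just k → toℕ k ≡ suc (toℕ j)
nxt-toℕ {suc (suc m)} {zero} refl = refl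
nxt-toℕ {suc (suc m)} {suc j} e with nxt j in e′
nxt-toℕ {suc (suc m)} {suc j} refl | just k = cong suc (nxt-toℕ e′)

lastM-toℕ : ∀ {m} {L : Fin m} → lastM m ≡ just L → suc (toℕ L) ≡ m
lastM-toℕ {suc m} refl = cong suc (Fin.toℕ-fromℕ m)

nxt-nothing : ∀ {m} {j : Fin m} → nxt j ≡ nothing → suc (toℕ j) ≡ m
nxt-nothing {j = j} e = lastM-toℕ (nxt-last j e)

prv-toℕ : ∀ {m} {j k : Fin m} → prv j ≡ just k → toℕ j ≡ suc (toℕ k)
prv-toℕ {j = suc j} refl = cong suc (sym (Fin.toℕ-inject₁ j))

prv-nothing : ∀ {m} {j : Fin m} → prv j ≡ nothing → toℕ j ≡ 0
prv-nothing {j = zero} _ = refl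

firstM-toℕ : ∀ {m} {k : Fin m} → firstM m ≡ just k → toℕ k ≡ 0
firstM-toℕ {suc m} refl = refl

lastM-nothing : ∀ {m} → lastM m ≡ nothing → m ≡ 0
lastM-nothing {zero} _ = refl

firstM-nothing : ∀ {m} → firstM m ≡ nothing → m ≡ 0
firstM-nothing {zero} _ = refl

4a+3≡3+[2a+2a] : ∀ a → 4 * a + 3 ≡ 3 + (2 * a + 2 * a)
4a+3≡3+[2a+2a] = solve-∀

4a+5≡5+[2a+2a] : ∀ a → 4 * a + 5 ≡ 5 + (2 * a + 2 * a)
4a+5≡5+[2a+2a] = solve-∀

half-suc-n : ∀ a i → ∃ λ h → h + h ≡ suc (nOf a i)
half-suc-n a minus = 2 * a + 2 , lemma a
  where
  lemma : ∀ a → (2 * a + 2) + (2 * a + 2) ≡ suc (4 * a + 3)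
  lemma = solve-∀
half-suc-n a plus = 2 * a + 3 , lemma a
  where
  lemma : ∀ a → (2 * a + 3) + (2 * a + 3) ≡ suc (4 * a + 5)
  lemma = solve-∀

3≤n : ∀ a i → 3 ≤ nOf a i
3≤n a minus = ℕ.m≤n+m 3 (4 * a)
3≤n a plus = ℕ.≤-trans (ℕ.n≤1+n 3) (ℕ.≤-trans (ℕ.n≤1+n 4) (ℕ.m≤n+m 5 (4 * a)))

m∸n≡1+m∸1+n : ∀ m n → n < m → m ∸ n ≡ suc (m ∸ suc n)
m∸n≡1+m∸1+n (suc m) zero _ = refl
m∸n≡1+m∸1+n (suc m) (suc n) (s≤s n<m) = m∸n≡1+m∸1+n m n n<m

module _ {a : ℕ} where

  start : ∀ i → Pt a i
  start minus = α
  start plus = β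

  -- The position on the n-cycle of s, counted from 1 at start i; β′, fixed by s, gets 0.
  index : ∀ {i} → Pt a i → ℕ
  index β' = 0
  index (num' j) = 4 + (2 * a ∸ suc (toℕ j))
  index {minus} α = 1
  index {minus} α' = 2
  index {minus} β = 3
  index {minus} (num j) = 4 + (2 * a + toℕ j)
  index {plus} β = 1
  index {plus} γ = 2
  index {plus} α' = 3
  index {plus} δ = 4 + 2 * a
  index {plus} (num j) = 5 + (2 * a + toℕ j)
  index {plus} α = 5 + (2 * a + 2 * a)

  private
    num-step : ∀ c {j k : Fin (2 * a)} → nxt j ≡ just k → c + (2 * a + toℕ k) ≡ suc (c + (2 * a + toℕ j))
    num-step c {j} e = trans (cong (λ l → c + (2 * a + l)) (nxt-toℕ e))
                             (trans (cong (c +_) (ℕ.+-suc (2 * a) (toℕ j))) (ℕ.+-suc c _))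

    num′-step : ∀ {j k : Fin (2 * a)} → prv j ≡ just k → 2 * a ∸ suc (toℕ k) ≡ suc (2 * a ∸ suc (toℕ j))
    num′-step {j} {k} e = subst (λ l → 2 * a ∸ suc (toℕ k) ≡ suc (2 * a ∸ suc l)) (sym (prv-toℕ e))
                                (m∸n≡1+m∸1+n (2 * a) (suc (toℕ k)) (subst (_< 2 * a) (prv-toℕ e) (Fin.toℕ<n j)))

    num′-first : ∀ {j : Fin (2 * a)} → prv j ≡ nothing → 2 * a ≡ suc (2 * a ∸ suc (toℕ j))
    num′-first {j} e = subst (λ l → 2 * a ≡ suc (2 * a ∸ suc l)) (sym (prv-nothing e))
                             (m∸n≡1+m∸1+n (2 * a) 0 (subst (_< 2 * a) (prv-nothing e) (Fin.toℕ<n j)))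

    num′-last : ∀ {L : Fin (2 * a)} → lastM (2 * a) ≡ just L → 2 * a ∸ suc (toℕ L) ≡ 0
    num′-last e = trans (cong (2 * a ∸_) (lastM-toℕ e)) (ℕ.n∸n≡0 (2 * a))

  index-sfun : ∀ {i} (x : Pt a i) → x ≢ β' → sfun x ≢ start i → index (sfun x) ≡ suc (index x)
  index-sfun β' x≢β' _ = ⊥-elim (x≢β' refl)
  index-sfun {minus} α _ _ = refl
  index-sfun {minus} α' _ _ = refl
  index-sfun {minus} β _ s≢start with lastM (2 * a) in e
  ... | just L = cong (4 +_) (num′-last e)
  ... | nothing = ⊥-elim (s≢start refl)
  index-sfun {minus} (num' j) _ _ with prv j in e
  ... | just k = cong (4 +_) (num′-step e)
  ... | nothing = cong (4 +_) (trans (cong (2 * a +_) (prv-nothing e)) (trans (ℕ.+-identityʳ _) (num′-first e)))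
  index-sfun {minus} (num j) _ s≢start with nxt j in e
  ... | just k = num-step 4 e
  ... | nothing = ⊥-elim (s≢start refl)
  index-sfun {plus} β _ _ = refl
  index-sfun {plus} γ _ _ = refl
  index-sfun {plus} α' _ _ with lastM (2 * a) in e
  ... | just L = cong (4 +_) (num′-last e)
  ... | nothing = cong (4 +_) (lastM-nothing e)
  index-sfun {plus} (num' j) _ _ with prv j in e
  ... | just k = cong (4 +_) (num′-step e)
  ... | nothing = cong (4 +_) (num′-first e)
  index-sfun {plus} δ _ _ with firstM (2 * a) in e
  ... | just k = trans (cong (λ l → 5 + (2 * a + l)) (firstM-toℕ e)) (cong (5 +_) (ℕ.+-identityʳ _))
  ... | nothing = trans (cong (λ l → 5 + (l + l)) (firstM-nothing e)) (cong (5 +_) (sym (firstM-nothing e)))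
  index-sfun {plus} (num j) _ _ with nxt j in e
  ... | just k = num-step 5 e
  ... | nothing = trans (cong (λ l → 5 + (2 * a + l)) (sym (nxt-nothing e))) (cong (5 +_) (ℕ.+-suc (2 * a) (toℕ j)))
  index-sfun {plus} α _ s≢start = ⊥-elim (s≢start refl)

  index-sinv-start : ∀ i → index (sinv (start i)) ≡ nOf a i
  index-sinv-start minus with lastM (2 * a) in e
  ... | just L = trans (cong (3 +_) (trans (sym (ℕ.+-suc (2 * a) (toℕ L))) (cong (2 * a +_) (lastM-toℕ e))))
                       (sym (4a+3≡3+[2a+2a] a))
  ... | nothing = trans (cong (λ l → 3 + (l + l)) (sym (lastM-nothing e))) (sym (4a+3≡3+[2a+2a] a))
  index-sinv-start plus = sym (4a+5≡5+[2a+2a] a)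

  index≤n : ∀ {i} (x : Pt a i) → index x ≤ nOf a i
  index≤n {minus} x = subst (index x ≤_) (sym (4a+3≡3+[2a+2a] a)) (below x)
    where
    below : ∀ (x : Pt a minus) → index x ≤ 3 + (2 * a + 2 * a)
    below β' = z≤n
    below α = s≤s z≤n
    below α' = s≤s (s≤s z≤n)
    below β = ℕ.m≤m+n 3 _
    below (num' j) = ℕ.+-monoʳ-≤ 3 (ℕ.≤-trans (ℕ.∸-monoʳ-< (s≤s z≤n) (Fin.toℕ<n j)) (ℕ.m≤m+n _ _))
    below (num j) = ℕ.+-monoʳ-≤ 3 (subst (_≤ 2 * a + 2 * a) (ℕ.+-suc (2 * a) (toℕ j)) (ℕ.+-monoʳ-≤ (2 * a) (Fin.toℕ<n j)))
  index≤n {plus} x = subst (index x ≤_) (sym (4a+5≡5+[2a+2a] a)) (below x)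
    where
    below : ∀ (x : Pt a plus) → index x ≤ 5 + (2 * a + 2 * a)
    below β' = z≤n
    below β = s≤s z≤n
    below γ = s≤s (s≤s z≤n)
    below α' = s≤s (s≤s (s≤s z≤n))
    below (num' j) = ℕ.+-monoʳ-≤ 4 (ℕ.≤-trans (ℕ.m∸n≤m (2 * a) (suc (toℕ j))) (ℕ.≤-trans (ℕ.m≤m+n (2 * a) (2 * a)) (ℕ.n≤1+n _)))
    below δ = ℕ.+-monoʳ-≤ 4 (ℕ.≤-trans (ℕ.m≤m+n _ _) (ℕ.n≤1+n _))
    below (num j) = ℕ.+-monoʳ-≤ 5 (ℕ.+-monoʳ-≤ (2 * a) (ℕ.<⇒≤ (Fin.toℕ<n j)))
    below α = ℕ.≤-refl

  F : ∀ {i} → ℕ → Pt a i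
  F zero = β'
  F {i} (suc k) = to (sPerm i ^ k) (start i)

  index-start : ∀ i → index (start i) ≡ 1
  index-start minus = refl
  index-start plus = refl

  sfun-β' : ∀ {i} → sfun {a} {i} β' ≡ β'
  sfun-β' {minus} = refl
  sfun-β' {plus} = refl

  private
    F-index-≤1 : ∀ {i} (x : Pt a i) → index x ≤ 1 → F (index x) ≡ x
    F-index-≤1 β' _ = refl
    F-index-≤1 (num' j) (s≤s ())
    F-index-≤1 {minus} α _ = refl
    F-index-≤1 {minus} α' (s≤s ())
    F-index-≤1 {minus} β (s≤s ())
    F-index-≤1 {minus} (num j) (s≤s ())
    F-index-≤1 {plus} β _ = refl
    F-index-≤1 {plus} γ (s≤s ())
    F-index-≤1 {plus} α' (s≤s ())
    F-index-≤1 {plus} δ (s≤s ())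
    F-index-≤1 {plus} (num j) (s≤s ())
    F-index-≤1 {plus} α (s≤s ())

  F-index : ∀ {i} (x : Pt a i) → F (index x) ≡ x
  F-index {i} x = go (index x) x refl
    where
    go : ∀ k (x : Pt a i) → index x ≡ k → F k ≡ x
    go 0 x e = subst (λ k → F k ≡ x) e (F-index-≤1 x (subst (_≤ 1) (sym e) z≤n))
    go 1 x e = subst (λ k → F k ≡ x) e (F-index-≤1 x (subst (_≤ 1) (sym e) ℕ.≤-refl))
    go (suc (suc k)) x e = begin
      sfun (F (suc k))   ≡⟨ cong sfun (go (suc k) (sinv x) (ℕ.suc-injective index-step)) ⟩
      sfun (sinv x)      ≡⟨ sfun-sinv x ⟩
      x                  ∎
      where
      open ≡-Reasoning
      sinv-x≢β' : sinv x ≢ β'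
      sinv-x≢β' e′ with () ← trans (sym e) (cong index (trans (sym (sfun-sinv x)) (trans (cong sfun e′) sfun-β')))
      x≢start : sfun (sinv x) ≢ start i
      x≢start e′ with () ← ℕ.suc-injective (trans (sym e) (trans (cong index (trans (sym (sfun-sinv x)) e′)) (index-start i)))
      index-step : suc (index (sinv x)) ≡ suc (suc k)
      index-step = trans (sym (index-sfun (sinv x) sinv-x≢β' x≢start)) (trans (cong index (sfun-sinv x)) e)

  index-F : ∀ {i} k → k ≤ nOf a i → index (F {i} k) ≡ k
  index-F 0 _ = refl
  index-F {i} 1 _ = index-start i
  index-F {i} (suc (suc k)) k+2≤n = step (index-F (suc k) (ℕ.≤-trans (ℕ.n≤1+n _) k+2≤n))
    where
    step : index (F {i} (suc k)) ≡ suc k → index (F {i} (suc (suc k))) ≡ suc (suc k)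
    step IH = trans (index-sfun (F (suc k)) Fk≢β' sFk≢start) (cong suc IH)
      where
      Fk≢β' : F (suc k) ≢ β'
      Fk≢β' e with () ← trans (sym IH) (cong index e)
      sFk≢start : sfun (F (suc k)) ≢ start i
      sFk≢start e = ℕ.<-irrefl (trans (sym IH) (trans (cong index Fk≡) (index-sinv-start i))) k+2≤n
        where
        Fk≡ : F (suc k) ≡ sinv (start i)
        Fk≡ = trans (sym (sinv-sfun (F (suc k)))) (cong sinv e)

  F-injective : ∀ {i j k} → j ≤ nOf a i → k ≤ nOf a i → F {i} j ≡ F k → j ≡ k
  F-injective j≤n k≤n e = trans (sym (index-F _ j≤n)) (trans (cong index e) (index-F _ k≤n))

  index-injective : ∀ {i} {x y : Pt a i} → index x ≡ index y → x ≡ y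
  index-injective {x = x} {y} e = trans (sym (F-index x)) (trans (cong F e) (F-index y))

  _≟ₚ_ : ∀ {i} → DecidableEquality (Pt a i)
  x ≟ₚ y = map′ index-injective (cong index) (index x ℕ.≟ index y)

-- The elements qⱼ⁻¹ qₖ of G

qIndices : Sgn → IndexList
qIndices minus = (1 , 0) ∷ (1 , 3) ∷ (1 , 2) ∷ []
qIndices plus = (1 , 2) ∷ (1 , 0) ∷ []

qIndices-distinct : ∀ i → All (λ (b , c) → b ≢ c) (qIndices i)
qIndices-distinct minus = (λ ()) ∷ (λ ()) ∷ (λ ()) ∷ []
qIndices-distinct plus = (λ ()) ∷ (λ ()) ∷ []

qIndices-bounded : ∀ i → Bounded 3 (qIndices i)
qIndices-bounded minus = from-yes (bounded? 3 (qIndices minus))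
qIndices-bounded plus = from-yes (bounded? 3 (qIndices plus))

module _ {a : ℕ} where

  module _ {i : Sgn} where
    open Transpositions (_≟ₚ_ {a} {i}) public
    open Realisation (_≟ₚ_ {a} {i}) (F {a} {i}) (nOf a i) F-injective index index≤n F-index public

  reflect : ∀ {i} → Pt a i → Pt a i
  reflect (num j) = num' j
  reflect (num' j) = num j
  reflect β' = β'
  reflect {minus} α = β
  reflect {minus} β = α
  reflect {minus} α' = α'
  reflect {plus} α = α'
  reflect {plus} α' = α
  reflect {plus} β = γ
  reflect {plus} γ = β
  reflect δ = δ

  reflect-involutive : ∀ {i} (x : Pt a i) → reflect (reflect x) ≡ x
  reflect-involutive (num j) = refl
  reflect-involutive (num' j) = refl
  reflect-involutive β' = refl
  reflect-involutive {minus} α = refl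
  reflect-involutive {minus} β = refl
  reflect-involutive {minus} α' = refl
  reflect-involutive {plus} α = refl
  reflect-involutive {plus} α' = refl
  reflect-involutive {plus} β = refl
  reflect-involutive {plus} γ = refl
  reflect-involutive δ = refl

  ρ : ∀ i → Perm (Pt a i)
  ρ i = perm reflect reflect reflect-involutive reflect-involutive

  q≋⟦qIndices⟧ : ∀ i → (ρ i ⨾ tPerm i) ≋ ⟦ qIndices i ⟧
  q≋⟦qIndices⟧ minus = mk≋ λ { (num j) → refl ; (num' j) → refl ; α → refl ; α' → refl ; β → refl ; β' → refl }
  q≋⟦qIndices⟧ plus = mk≋ λ { (num j) → refl ; (num' j) → refl ; α → refl ; α' → refl ; β → refl ; β' → refl ; γ → refl ; δ → refl }

  reflect-reverses : ∀ {i} (x : Pt a i) → reflect (sinv (reflect x)) ≡ sfun x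
  reflect-reverses {minus} β' = refl
  reflect-reverses {plus} β' = refl
  reflect-reverses {minus} (num j) with nxt j
  ... | just k = refl
  ... | nothing = refl
  reflect-reverses {minus} (num' j) with prv j
  ... | just k = refl
  ... | nothing = refl
  reflect-reverses {minus} α = refl
  reflect-reverses {minus} α' = refl
  reflect-reverses {minus} β with lastM (2 * a)
  ... | just k = refl
  ... | nothing = refl
  reflect-reverses {plus} (num j) with nxt j
  ... | just k = refl
  ... | nothing = refl
  reflect-reverses {plus} (num' j) with prv j
  ... | just k = refl
  ... | nothing = refl
  reflect-reverses {plus} α = refl
  reflect-reverses {plus} β = refl
  reflect-reverses {plus} γ = refl
  reflect-reverses {plus} α' with lastM (2 * a)
  ... | just k = refl
  ... | nothing = refl
  reflect-reverses {plus} δ with firstM (2 * a)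
  ... | just k = refl
  ... | nothing = refl

module _ {a : ℕ} {i : Sgn} where

  s t q : Perm (Pt a i)
  s = sPerm i
  t = tPerm i
  q = ρ i ⨾ t

  record G (p : Perm (Pt a i)) : Set where
    constructor ⟪_⟫
    field ∈G : InG i p
  open G public

  G-isSubgroup : IsSubgroup G
  G-isSubgroup = record
    { ∈-resp-≋ = λ { e ⟪ g , g-gen , g≈ ⟫ → ⟪ g , g-gen , (λ x → trans (g≈ x) (app e x)) ⟫ }
    ; ∈-⨾ = λ { {p₁} {p₂} ⟪ g , g-gen , g≈ ⟫ ⟪ h , h-gen , h≈ ⟫ →
                ⟪ g ⨾ h , mul g-gen h-gen , app (⨾-cong {p = g} {p₁} {h} {p₂} (mk≋ g≈) (mk≋ h≈)) ⟫ }
    ; ∈-⁻¹ = λ { {p} ⟪ g , g-gen , g≈ ⟫ → ⟪ g ⁻¹ , inv g-gen , app (⁻¹-cong {p = g} {p} (mk≋ g≈)) ⟫ }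
    ; ∈-id = ⟪ idP , unit , (λ _ → refl) ⟫
    }

  open IsSubgroup G-isSubgroup

  s∈G : G s
  s∈G = ⟪ s , gen₁ , (λ _ → refl) ⟫

  t∈G : G t
  t∈G = ⟪ t , gen₂ , (λ _ → refl) ⟫

  s^-β' : ∀ k → to (s ^ k) β' ≡ β'
  s^-β' zero = refl
  s^-β' (suc k) = trans (cong sfun (s^-β' k)) sfun-β'

  s^-F : ∀ j k → to (s ^ j) (F k) ≡ F (shiftIndex j k)
  s^-F j zero = s^-β' j
  s^-F j (suc k) = sym (app (^-+ s k j) (start i))

  s^-sfun : ∀ k w → to (s ^ k) (sfun w) ≡ sfun (to (s ^ k) w)
  s^-sfun k w = sym (app (^-commute s k) w)

  s^-from-sfun : ∀ k (w : Pt a i) → from (s ^ k) (sfun w) ≡ sfun (from (s ^ k) w)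
  s^-from-sfun k w = begin
    from (s ^ k) (sfun w)                               ≡⟨ cong (λ z → from (s ^ k) (sfun z)) (sym (to∘from (s ^ k) w)) ⟩
    from (s ^ k) (sfun (to (s ^ k) (from (s ^ k) w)))   ≡⟨ cong (from (s ^ k)) (sym (s^-sfun k (from (s ^ k) w))) ⟩
    from (s ^ k) (to (s ^ k) (sfun (from (s ^ k) w)))   ≡⟨ from∘to (s ^ k) _ ⟩
    sfun (from (s ^ k) w)                               ∎
    where open ≡-Reasoning

  1≤n : 1 ≤ nOf a i
  1≤n = subst (_≤ nOf a i) (index-start i) (index≤n (start i))

  s^n-start : to (s ^ nOf a i) (start i) ≡ start i
  s^n-start = go (nOf a i) refl 1≤n
    where
    go : ∀ k → k ≡ nOf a i → 1 ≤ k → to (s ^ k) (start i) ≡ start i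
    go (suc k) k+1≡n _ = trans (cong sfun (index-injective index≡)) (sfun-sinv (start i))
      where
      index≡ : index (F {i = i} (suc k)) ≡ index (sinv (start i))
      index≡ = trans (index-F (suc k) (ℕ.≤-reflexive k+1≡n)) (trans k+1≡n (sym (index-sinv-start i)))

  s^n≋id : (s ^ nOf a i) ≋ idP
  s^n≋id = mk≋ λ x → trans (cong (to (s ^ nOf a i)) (sym (F-index x))) (trans (on-F (index x)) (F-index x))
    where
    on-F : ∀ k → to (s ^ nOf a i) (F k) ≡ F k
    on-F zero = s^-β' (nOf a i)
    on-F (suc k) = begin
      to (s ^ nOf a i) (to (s ^ k) (start i))   ≡⟨ app (^-+ s k (nOf a i)) (start i) ⟨
      to (s ^ (k + nOf a i)) (start i)          ≡⟨ cong (λ l → to (s ^ l) (start i)) (ℕ.+-comm k (nOf a i)) ⟩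
      to (s ^ (nOf a i + k)) (start i)          ≡⟨ app (^-+ s (nOf a i) k) (start i) ⟩
      to (s ^ k) (to (s ^ nOf a i) (start i))   ≡⟨ cong (to (s ^ k)) s^n-start ⟩
      to (s ^ k) (start i)                      ∎
      where open ≡-Reasoning

  s-hasOrder : HasOrder s (nOf a i)
  s-hasOrder = 1≤n , app s^n≋id , λ k 1≤k k<n s^k≈id →
    ℕ.<-irrefl (sym (ℕ.suc-injective (F-injective k<n 1≤n (s^k≈id (start i))))) 1≤k

  reflect-s^ : ∀ k w → reflect (from (s ^ k) (reflect w)) ≡ to (s ^ k) w
  reflect-s^ zero w = reflect-involutive w
  reflect-s^ (suc k) w = begin
    reflect (from (s ^ k) (sinv (reflect w)))            ≡⟨ cong (λ z → reflect (from (s ^ k) z)) sinv-reflect ⟩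
    reflect (from (s ^ k) (reflect (sfun w)))            ≡⟨ reflect-s^ k (sfun w) ⟩
    to (s ^ k) (sfun w)                                  ≡⟨ s^-sfun k w ⟩
    sfun (to (s ^ k) w)                                  ∎
    where
    open ≡-Reasoning
    sinv-reflect : sinv (reflect w) ≡ reflect (sfun w)
    sinv-reflect = trans (sym (reflect-involutive _)) (cong reflect (reflect-reverses w))

  Q : ℕ → Perm (Pt a i)
  Q j = conj (s ^ j) q

  pair : ℕ × ℕ → Perm (Pt a i)
  pair (j , k) = (Q j ⁻¹) ⨾ Q k

  word : List (ℕ × ℕ) → Perm (Pt a i)
  word e = product (map pair e)

  y : ℕ → Perm (Pt a i)
  y d = ((t ⨾ (s ^ d)) ⨾ t) ⨾ (s ^ d)

  y≋pair : ∀ d → y d ≋ pair (0 , d)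
  y≋pair d = mk≋ λ x → cong (λ z → to (s ^ d) (tfun z)) (sym (reflect-s^ d (tfun x)))

  conj-Q : ∀ j k → conj (s ^ j) (Q k) ≋ Q (k + j)
  conj-Q j k = ≋-trans (conj-conj (s ^ k) (s ^ j) q) (conj-congˡ q (≋-sym (^-+ s k j)))

  conj-pair : ∀ j k l → conj (s ^ j) (pair (k , l)) ≋ pair (k + j , l + j)
  conj-pair j k l = ≋-trans (conj-⨾ (s ^ j) (Q k ⁻¹) (Q l)) (⨾-cong (≋-trans (conj-⁻¹ (s ^ j) (Q k)) (⁻¹-cong (conj-Q j k))) (conj-Q j l))

  pair-⁻¹ : ∀ j k → (pair (j , k) ⁻¹) ≋ pair (k , j)
  pair-⁻¹ j k = mk≋ λ _ → refl

  y∈G : ∀ d → G (y d)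
  y∈G d = ∈-⨾ (∈-⨾ (∈-⨾ t∈G (∈-^ d s∈G)) t∈G) (∈-^ d s∈G)

  conj-y≋pair : ∀ j d → conj (s ^ j) (y d) ≋ pair (j , d + j)
  conj-y≋pair j d = ≋-trans (conj-cong (s ^ j) (y≋pair d)) (conj-pair j 0 d)

  ascending-pair∈G : ∀ j d → G (pair (j , d + j))
  ascending-pair∈G j d = ∈-resp-≋ (conj-y≋pair j d) (∈-conj (∈-^ j s∈G) (y∈G d))

  conj-descending-pair : ∀ J c d → conj ((s ^ (J + c)) ⁻¹) (pair (d + J , J)) ≋ conj ((s ^ c) ⁻¹) (y d ⁻¹)
  conj-descending-pair J c d = begin
    conj ((s ^ (J + c)) ⁻¹) (pair (d + J , J))
      ≈⟨ conj-cong ((s ^ (J + c)) ⁻¹) mirrored ⟩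
    conj ((s ^ (J + c)) ⁻¹) (conj (s ^ J) (y d ⁻¹))
      ≈⟨ conj-conj (s ^ J) ((s ^ (J + c)) ⁻¹) (y d ⁻¹) ⟩
    conj ((s ^ J) ⨾ ((s ^ (J + c)) ⁻¹)) (y d ⁻¹)
      ≈⟨ conj-congˡ (y d ⁻¹) (^-⨾-^⁻¹ s J c) ⟩
    conj ((s ^ c) ⁻¹) (y d ⁻¹)
      ∎
    where
    open ≋-Reasoning
    mirrored : pair (d + J , J) ≋ conj (s ^ J) (y d ⁻¹)
    mirrored = ≋-trans (≋-sym (pair-⁻¹ J (d + J)))
                 (≋-trans (⁻¹-cong (≋-sym (conj-y≋pair J d))) (≋-sym (conj-⁻¹ (s ^ J) (y d))))

  pair∈G : ∀ jk → G (pair jk)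
  pair∈G (j , k) with ℕ.≤-total j k
  ... | inj₁ j≤k = subst (λ l → G (pair (j , l))) (ℕ.m∸n+n≡m j≤k) (ascending-pair∈G j (k ∸ j))
  ... | inj₂ k≤j = ∈-resp-≋ (pair-⁻¹ k j) (∈-⁻¹ (subst (λ l → G (pair (k , l))) (ℕ.m∸n+n≡m k≤j) (ascending-pair∈G k (j ∸ k))))

  word∈G : ∀ e → G (word e)
  word∈G [] = ∈-id
  word∈G (jk ∷ e) = ∈-⨾ (pair∈G jk) (word∈G e)

  word-++ : ∀ e e′ → word (e ++ e′) ≋ (word e ⨾ word e′)
  word-++ e e′ = ≋-trans (≋-reflexive (cong product (map-++ pair e e′))) (product-++ (map pair e) (map pair e′))

  word-^ : ∀ e k → (word e ^ k) ≋ word (concat (replicate k e))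
  word-^ e zero = ≋-refl
  word-^ e (suc k) = begin
    (word e ^ k) ⨾ word e                     ≈⟨ ^-commute (word e) k ⟩
    word e ⨾ (word e ^ k)                     ≈⟨ ⨾-cong (≋-refl {p = word e}) (word-^ e k) ⟩
    word e ⨾ word (concat (replicate k e))    ≈⟨ word-++ e _ ⟨
    word (concat (replicate (suc k) e))       ∎
    where open ≋-Reasoning

  Q≋ : ∀ j → Q j ≋ ⟦ shift j (qIndices i) ⟧
  Q≋ j = ≋-trans (conj-cong (s ^ j) (q≋⟦qIndices⟧ i)) (⟦⟧-conj (s ^ j) (shiftIndex j) (s^-F j) (qIndices i))

  pair≋ : ∀ jk → pair jk ≋ ⟦ pairIndices (qIndices i) jk ⟧
  pair≋ (j , k) = ≋-sym (begin
    ⟦ reverse (shift j L) ++ shift k L ⟧          ≈⟨ ⟦⟧-++ (reverse (shift j L)) (shift k L) ⟩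
    ⟦ reverse (shift j L) ⟧ ⨾ ⟦ shift k L ⟧       ≈⟨ ⨾-cong (⟦⟧-reverse (shift j L)) (≋-sym (Q≋ k)) ⟩
    (⟦ shift j L ⟧ ⁻¹) ⨾ Q k                      ≈⟨ ⨾-cong (⁻¹-cong (≋-sym (Q≋ j))) (≋-refl {p = Q k}) ⟩
    pair (j , k)                                  ∎)
    where
    open ≋-Reasoning
    L : IndexList
    L = qIndices i

  word≋ : ∀ e → word e ≋ ⟦ wordIndices (qIndices i) e ⟧
  word≋ [] = ≋-refl
  word≋ (jk ∷ e) = ≋-trans (⨾-cong (pair≋ jk) (word≋ e)) (≋-sym (⟦⟧-++ (pairIndices (qIndices i) jk) (wordIndices (qIndices i) e)))

-- Certificates, checked by evaluation

indexBound : Sgn → ℕ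
indexBound minus = 10
indexBound plus = 9

indexBound≤n : ∀ a i → 9 ≤ nOf a i → indexBound i ≤ nOf a i
indexBound≤n zero minus (s≤s (s≤s (s≤s ())))
indexBound≤n (suc zero) minus (s≤s (s≤s (s≤s (s≤s (s≤s (s≤s (s≤s ())))))))
indexBound≤n (suc (suc b)) minus _ = subst (10 ≤_) (sym (lemma b)) (ℕ.≤-trans (ℕ.n≤1+n 10) (ℕ.m≤m+n 11 (4 * b)))
  where
  lemma : ∀ b → 4 * suc (suc b) + 3 ≡ 11 + 4 * b
  lemma = solve-∀
indexBound≤n a plus 9≤n = 9≤n

cycle₁₂₃-word cycle₀₁₂-word : Sgn → List (ℕ × ℕ)
cycle₁₂₃-word minus = (2 , 5) ∷ (3 , 0) ∷ (4 , 5) ∷ (0 , 4) ∷ (1 , 3) ∷ []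
cycle₁₂₃-word plus = (2 , 3) ∷ (1 , 3) ∷ (4 , 0) ∷ (2 , 4) ∷ []
cycle₀₁₂-word minus = (3 , 5) ∷ (0 , 1) ∷ (2 , 0) ∷ (5 , 3) ∷ (0 , 1) ∷ []
cycle₀₁₂-word plus = (0 , 3) ∷ (4 , 2) ∷ (0 , 3) ∷ (4 , 2) ∷ []

cycle₁₂₃-word-agrees : ∀ i → Agree (indexBound i) (wordIndices (qIndices i) (cycle₁₂₃-word i)) ((1 , 2) ∷ (1 , 3) ∷ [])
cycle₁₂₃-word-agrees minus = agree-by-evaluation
cycle₁₂₃-word-agrees plus = agree-by-evaluation

cycle₀₁₂-word-agrees : ∀ i → Agree (indexBound i) (wordIndices (qIndices i) (cycle₀₁₂-word i)) ((0 , 1) ∷ (0 , 2) ∷ [])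
cycle₀₁₂-word-agrees minus = agree-by-evaluation
cycle₀₁₂-word-agrees plus = agree-by-evaluation

A-word B-word : List (ℕ × ℕ)
A-word = (4 , 3) ∷ (2 , 0) ∷ []
B-word = (3 , 4) ∷ (5 , 7) ∷ []

separatingExponent : Sgn → ℕ
separatingExponent minus = 3
separatingExponent plus = 6

B-word-power-trivial : ∀ i → Agree (indexBound i) (wordIndices (qIndices i) (concat (replicate (separatingExponent i) B-word))) []
B-word-power-trivial minus = agree-by-evaluation
B-word-power-trivial plus = agree-by-evaluation

A-word-power-moves-0 : ∀ i → MovesZero (indexBound i) (wordIndices (qIndices i) (concat (replicate (separatingExponent i) A-word)))
A-word-power-moves-0 minus = moves-by-evaluation
A-word-power-moves-0 plus = moves-by-evaluation

-- G = Alt(Ω)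

module _ {a : ℕ} {i : Sgn} where

  open IsSubgroup (G-isSubgroup {a} {i})

  module _ (K≤n : indexBound i ≤ nOf a i) where

    private
      4≤n : 4 ≤ nOf a i
      4≤n = ℕ.≤-trans (4≤indexBound i) K≤n
        where
        4≤indexBound : ∀ i → 4 ≤ indexBound i
        4≤indexBound minus = ℕ.m≤m+n 4 6
        4≤indexBound plus = ℕ.m≤m+n 4 5

    cycle₃-from-word : ∀ e x y z → Agree (indexBound i) (wordIndices (qIndices i) e) ((x , y) ∷ (x , z) ∷ []) →
                       G (cycle₃ (F {a} {i} x) (F y) (F z))
    cycle₃-from-word e x y z agrees =
      ∈-resp-≋ (≋-trans (word≋ e) (≋-trans (⟦⟧-agree K≤n agrees) (⟦⟧-cycle₃ x y z))) (word∈G e)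

    s-shifts : ∀ k → G (cycle₃ (F {a} {i} (suc k)) (F (suc (suc k))) (F (suc (suc (suc k))))) →
               G (cycle₃ (F (suc (suc k))) (F (suc (suc (suc k)))) (F (suc (suc (suc (suc k))))))
    s-shifts k = ∈-cycle₃-conj G-isSubgroup {x′ = F (suc (suc k))} {F (suc (suc (suc k)))} {F (suc (suc (suc (suc k))))}
                               s∈G refl refl refl

    window : ∀ k → G (cycle₃ (F {a} {i} k) (F (suc k)) (F (suc (suc k))))
    window zero = cycle₃-from-word (cycle₀₁₂-word i) zero (suc zero) (suc (suc zero)) (cycle₀₁₂-word-agrees i)
    window (suc zero) = cycle₃-from-word (cycle₁₂₃-word i) (suc zero) (suc (suc zero)) (suc (suc (suc zero))) (cycle₁₂₃-word-agrees i)
    window (suc (suc k)) = s-shifts k (window (suc k))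

    G-has3Cycles : Has3Cycles (G-isSubgroup {a} {i})
    G-has3Cycles = Fan.has3Cycles G-isSubgroup F0≢F1 fan
      where
      F0≢F1 : F {a} {i} 0 ≢ F 1
      F0≢F1 e with () ← trans (cong index e) (index-start i)
      fan : ∀ z → z ≢ F 0 → z ≢ F 1 → G (cycle₃ (F 0) (F 1) z)
      fan z z≢F0 z≢F1 = subst (λ w → G (cycle₃ (F 0) (F 1) w)) (F-index z)
                              (windows⇒fan G-isSubgroup F F-injective 4≤n window (index z) 2≤index (index≤n z))
        where
        2≤index : 2 ≤ index z
        2≤index with index z in e
        ... | 0 = ⊥-elim (z≢F0 (trans (sym (F-index z)) (cong F e)))
        ... | 1 = ⊥-elim (z≢F1 (trans (sym (F-index z)) (cong F e)))
        ... | suc (suc _) = s≤s (s≤s z≤n)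

    Alt⊆G : ∀ {p} → IsEven p → InG i p
    Alt⊆G {p} even = ∈G (3cycles⇒even G-isSubgroup G-has3Cycles {p} even)

  swapNum : Fin (2 * a) → Perm (Pt a i)
  swapNum j = swap (num j) (num' j)

  swapNums : List (Fin (2 * a)) → Perm (Pt a i)
  swapNums js = product (map swapNum js)

  swapNums-fixes : ∀ js {x} → All (λ j → x ≢ num j × x ≢ num' j) js → to (swapNums js) x ≡ x
  swapNums-fixes [] [] = refl
  swapNums-fixes (j ∷ js) ((x≢j , x≢j′) ∷ rest) = trans (cong (to (swapNums js)) (swapᶠ-o x≢j x≢j′)) (swapNums-fixes js rest)

  swapNums-num : ∀ {js k} → Unique js → k ∈ js → to (swapNums js) (num k) ≡ num' k
  swapNums-num {j ∷ js} (j∉js ∷ _) (here refl) =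
    trans (cong (to (swapNums js)) (swapᶠ-l (num j) (num' j)))
          (swapNums-fixes js (All.map (λ j≢l → (λ ()) , λ { refl → j≢l refl }) j∉js))
  swapNums-num {j ∷ js} (j∉js ∷ u) (there k∈js) =
    trans (cong (to (swapNums js)) (swapᶠ-o {x = num j} {y = num' j} (λ { refl → All.lookup j∉js k∈js refl }) (λ ()))) (swapNums-num u k∈js)

  swapNums-num' : ∀ {js k} → Unique js → k ∈ js → to (swapNums js) (num' k) ≡ num k
  swapNums-num' {j ∷ js} (j∉js ∷ _) (here refl) =
    trans (cong (to (swapNums js)) (swapᶠ-r (num j) (num' j)))
          (swapNums-fixes js (All.map (λ j≢l → (λ { refl → j≢l refl }) , λ ()) j∉js))
  swapNums-num' {j ∷ js} (j∉js ∷ u) (there k∈js) =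
    trans (cong (to (swapNums js)) (swapᶠ-o {x = num j} {y = num' j} (λ ()) (λ { refl → All.lookup j∉js k∈js refl }))) (swapNums-num' u k∈js)

  tTranspositions : List (Perm (Pt a i))
  tTranspositions = swap α α' ∷ swap β β' ∷ map swapNum (allFin (2 * a))

  t-decomposition : product tTranspositions ≋ t
  t-decomposition = mk≋ λ where
      (num k) → trans (cong (to all) (trans (cong (swapᶠ β β') (off-α {num k} (λ ()) (λ ()))) (off-β (λ ()) (λ ()))))
                      (swapNums-num (allFin⁺ _) (∈-allFin k))
      (num' k) → trans (cong (to all) (trans (cong (swapᶠ β β') (off-α {num' k} (λ ()) (λ ()))) (off-β (λ ()) (λ ()))))
                       (swapNums-num' (allFin⁺ _) (∈-allFin k))
      α → trans (cong (to all) (trans (cong (swapᶠ β β') (swapᶠ-l α α')) (off-β (λ ()) (λ ())))) (fixes (λ _ ()) (λ _ ()))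
      α' → trans (cong (to all) (trans (cong (swapᶠ β β') (swapᶠ-r α α')) (off-β (λ ()) (λ ())))) (fixes (λ _ ()) (λ _ ()))
      β → trans (cong (to all) (trans (cong (swapᶠ β β') (off-α {β} (λ ()) (λ ()))) (swapᶠ-l β β'))) (fixes (λ _ ()) (λ _ ()))
      β' → trans (cong (to all) (trans (cong (swapᶠ β β') (off-α {β'} (λ ()) (λ ()))) (swapᶠ-r β β'))) (fixes (λ _ ()) (λ _ ()))
      γ → trans (cong (to all) (trans (cong (swapᶠ β β') (off-α {γ} (λ ()) (λ ()))) (off-β (λ ()) (λ ())))) (fixes (λ _ ()) (λ _ ()))
      δ → trans (cong (to all) (trans (cong (swapᶠ β β') (off-α {δ} (λ ()) (λ ()))) (off-β (λ ()) (λ ())))) (fixes (λ _ ()) (λ _ ()))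
    where
    all : Perm (Pt a i)
    all = swapNums (allFin (2 * a))
    off-α : ∀ {z : Pt a i} → z ≢ α → z ≢ α' → swapᶠ α α' z ≡ z
    off-α = swapᶠ-o
    off-β : ∀ {z : Pt a i} → z ≢ β → z ≢ β' → swapᶠ β β' z ≡ z
    off-β = swapᶠ-o
    fixes : ∀ {x} → (∀ j → x ≢ num j) → (∀ j → x ≢ num' j) → to all x ≡ x
    fixes x≢num x≢num′ = swapNums-fixes (allFin (2 * a)) (All.tabulate λ {j} _ → x≢num j , x≢num′ j)

  tTranspositions-valid : All IsTransposition tTranspositions
  tTranspositions-valid = swap-isTransposition α α' (λ ()) ∷ swap-isTransposition β β' (λ ())
                          ∷ map⁺ (All.tabulate λ {j} _ → swap-isTransposition (num j) (num' j) (λ ()))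

  t-isEven : IsEven t
  t-isEven = tTranspositions
           , tTranspositions-valid
           , subst (λ l → 2 ∣ 2 + l) (sym (trans (length-map swapNum (allFin (2 * a))) (length-tabulate (λ j → j))))
                   (∣m∣n⇒∣m+n (∣-refl {2}) (m∣m*n a))
           , app t-decomposition

  qTranspositions : List (Perm (Pt a i))
  qTranspositions = map transposition (qIndices i)

  qTranspositions-valid : All IsTransposition qTranspositions
  qTranspositions-valid = map⁺ (All.map valid (All.zip (qIndices-distinct i , qIndices-bounded i)))
    where
    valid : ∀ {bc : ℕ × ℕ} → proj₁ bc ≢ proj₂ bc × proj₁ bc ≤ 3 × proj₂ bc ≤ 3 → IsTransposition (transposition bc)
    valid {b , c} (b≢c , b≤3 , c≤3) =
      swap-isTransposition (F b) (F c) λ e → b≢c (F-injective (ℕ.≤-trans b≤3 (3≤n a i)) (ℕ.≤-trans c≤3 (3≤n a i)) e)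

  ρ-decomposition : product (qTranspositions ++ tTranspositions) ≋ ρ i
  ρ-decomposition = begin
    product (qTranspositions ++ tTranspositions)          ≈⟨ product-++ qTranspositions tTranspositions ⟩
    product qTranspositions ⨾ product tTranspositions     ≈⟨ ⨾-cong {p = product qTranspositions} {p′ = ρ i ⨾ t}
                                                                    {q = product tTranspositions} {q′ = t}
                                                                    (≋-sym (q≋⟦qIndices⟧ i)) t-decomposition ⟩
    (ρ i ⨾ t) ⨾ t                                         ≈⟨ mk≋ (λ x → tfun-inv (reflect x)) ⟩
    ρ i                                                    ∎
    where open ≋-Reasoning

  s≋ρ⨾conj : ∀ h → h + h ≡ suc (nOf a i) → (ρ i ⨾ conj (s ^ h) (ρ i)) ≋ s
  s≋ρ⨾conj h h+h≡n+1 = mk≋ λ x → begin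
    to (s ^ h) (reflect (from (s ^ h) (reflect x)))   ≡⟨ cong (to (s ^ h)) (reflect-s^ h x) ⟩
    to (s ^ h) (to (s ^ h) x)                         ≡⟨ app (^-+ s h h) x ⟨
    to (s ^ (h + h)) x                                ≡⟨ cong (λ k → to (s ^ k) x) h+h≡n+1 ⟩
    sfun (to (s ^ nOf a i) x)                         ≡⟨ cong sfun (app s^n≋id x) ⟩
    sfun x                                            ∎
    where open ≡-Reasoning

  s-isEven : IsEven s
  s-isEven = IsSubgroup.∈-resp-≋ isEven-isSubgroup {q = s} (s≋ρ⨾conj (proj₁ (half-suc-n a i)) (proj₂ (half-suc-n a i)))
               (isEven-⨾-conj (s ^ proj₁ (half-suc-n a i)) (qTranspositions ++ tTranspositions)
                 (++⁺ qTranspositions-valid tTranspositions-valid) ρ-decomposition)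

  G⊆Alt : ∀ {p} → InG i p → IsEven p
  G⊆Alt {p} (g , g-gen , g≈p) =
    IsSubgroup.∈-resp-≋ isEven-isSubgroup {g} {p} (mk≋ g≈p) (⟨⟩-least isEven-isSubgroup s-isEven t-isEven g-gen)

-- The orders of r and r s

module _ {a : ℕ} where

  private
    R : ∀ {i} → Pt a i → Pt a i
    R {i} = to (rPerm i)

    2-cycle : ∀ {i} {x y : Pt a i} → R x ≡ y → R y ≡ x → R (R (R (R x))) ≡ x
    2-cycle {x = x} {y} Rx≡y Ry≡x = trans (cong (λ z → R (R (R z))) Rx≡y) (trans (cong (λ z → R (R z)) Ry≡x)
                                      (trans (cong R Rx≡y) Ry≡x))

    4-cycle : ∀ {i} {x₁ x₂ x₃ x₄ : Pt a i} → R x₁ ≡ x₂ → R x₂ ≡ x₃ → R x₃ ≡ x₄ → R x₄ ≡ x₁ →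
              R (R (R (R x₁))) ≡ x₁
    4-cycle refl refl refl e = e

  r⁴≋id-minus : 1 ≤ a → (rPerm {a} minus ^ 4) ≋ idP
  r⁴≋id-minus 1≤a with lastM (2 * a) in last≡
  ... | nothing = ⊥-elim (ℕ.<-irrefl (sym (lastM-nothing last≡)) (ℕ.≤-trans 1≤a (ℕ.m≤m+n a (a + 0))))
  ... | just last = mk≋ r⁴
    where
    Rα′ : R α' ≡ num last
    Rα′ = cong (maybe′ num β) last≡
    Rlast : R (num last) ≡ β
    Rlast = cong (maybe′ num' β) (last-nxt last last≡)
    r⁴ : ∀ (x : Pt a minus) → R (R (R (R x))) ≡ x
    r⁴ (num j) = via-nxt (nxt j) refl
      where
      via-nxt : ∀ m → nxt j ≡ m → R (R (R (R (num j)))) ≡ num j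
      via-nxt (just k) e = 2-cycle (cong (maybe′ num' β) e) (cong (maybe′ num (num' k)) (nxt-prv j k e))
      via-nxt nothing e = 4-cycle (cong (maybe′ num' β) e) refl refl (cong (maybe′ num β) (nxt-last j e))
    r⁴ (num' k) = via-prv (prv k) refl
      where
      via-prv : ∀ m → prv k ≡ m → R (R (R (R (num' k)))) ≡ num' k
      via-prv (just j) e = 2-cycle (cong (maybe′ num (num' k)) e) (cong (maybe′ num' β) (prv-nxt k j e))
      via-prv nothing e = 2-cycle (cong (maybe′ num (num' k)) e) (cong (maybe′ num (num' k)) e)
    r⁴ α = refl
    r⁴ β = 4-cycle refl refl Rα′ Rlast
    r⁴ β' = 4-cycle refl Rα′ Rlast refl
    r⁴ α' = 4-cycle Rα′ Rlast refl refl
  r⁴≋id-plus : (rPerm {a} plus ^ 4) ≋ idP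
  r⁴≋id-plus = mk≋ r⁴
    where
    r⁴ : ∀ (x : Pt a plus) → R (R (R (R x))) ≡ x
    r⁴ (num j) = via-nxt (nxt j) refl
      where
      via-nxt : ∀ m → nxt j ≡ m → R (R (R (R (num j)))) ≡ num j
      via-nxt (just k) e = 2-cycle (cong (maybe′ num' α') e) (cong (maybe′ num δ) (nxt-prv j k e))
      via-nxt nothing e = 2-cycle (cong (maybe′ num' α') e) (cong (maybe′ num δ) (nxt-last j e))
    r⁴ (num' k) = via-prv (prv k) refl
      where
      via-prv : ∀ m → prv k ≡ m → R (R (R (R (num' k)))) ≡ num' k
      via-prv (just j) e = 2-cycle (cong (maybe′ num δ) e) (cong (maybe′ num' α') (prv-nxt k j e))
      via-prv nothing e = 2-cycle (cong (maybe′ num δ) e) (cong (maybe′ num' α') (prv-first k e))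
    r⁴ α = refl
    r⁴ β = refl
    r⁴ γ = refl
    r⁴ β' = refl
    r⁴ α' = via-last (lastM (2 * a)) refl
      where
      via-last : ∀ m → lastM (2 * a) ≡ m → R (R (R (R α'))) ≡ α'
      via-last (just L) e = 2-cycle (cong (maybe′ num δ) e) (cong (maybe′ num' α') (last-nxt L e))
      via-last nothing e = 2-cycle (cong (maybe′ num δ) e) (cong (maybe′ num' α') (last-first _ e))
    r⁴ δ = via-first (firstM (2 * a)) refl
      where
      via-first : ∀ m → firstM (2 * a) ≡ m → R (R (R (R δ))) ≡ δ
      via-first (just k) e = 2-cycle (cong (maybe′ num' α') e) (cong (maybe′ num δ) (first-prv k e))
      via-first nothing e = 2-cycle (cong (maybe′ num' α') e) (cong (maybe′ num δ) (first-last _ e))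

  r²≉id : ∀ i → ¬ ((rPerm {a} i ^ 2) ≋ idP)
  r²≉id minus r²≋id with () ← app r²≋id β
  r²≉id plus r²≋id with () ← app r²≋id β

  r-hasOrder : ∀ i → 1 ≤ a → HasOrder (rPerm {a} i) 4
  r-hasOrder minus 1≤a = hasOrder-4 (r⁴≋id-minus 1≤a) (r²≉id minus)
  r-hasOrder plus _ = hasOrder-4 r⁴≋id-plus (r²≉id plus)

  rs-hasOrder : ∀ i → HasOrder (rPerm {a} i ⨾ sPerm i) 2
  rs-hasOrder i = hasOrder-2 (mk≋ rs²) rs≉id
    where
    rs² : ∀ x → sfun (sinv (tfun (sfun (sinv (tfun x))))) ≡ x
    rs² x = trans (cong (λ z → sfun (sinv (tfun z))) (sfun-sinv (tfun x))) (trans (sfun-sinv (tfun (tfun x))) (tfun-inv x))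
    rs≉id : ¬ ((rPerm i ⨾ sPerm i) ≋ idP)
    rs≉id rs≋id with () ← trans (sym (sfun-sinv α')) (app rs≋id α)

-- Chirality

module _ {a : ℕ} {i : Sgn} where

  open IsSubgroup (G-isSubgroup {a} {i})

  r : Perm (Pt a i)
  r = rPerm i

  r∈G : G r
  r∈G = ∈-⨾ t∈G (∈-⁻¹ s∈G)

  module _ (A : Automorphism (InG {a} i)) where
    open Automorphism A

    Φ : ∀ {p} → G p → Perm (Pt a i)
    Φ {p} p∈ = proj₁ (φ (p , ∈G p∈))

    Φ-cong : ∀ {p q} (p∈ : G p) (q∈ : G q) → p ≋ q → Φ p∈ ≋ Φ q∈
    Φ-cong {p} {q} p∈ q∈ p≋q = mk≋ (φ-cong (p , ∈G p∈) (q , ∈G q∈) (app p≋q))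

    Φ-injective : ∀ {p q} (p∈ : G p) (q∈ : G q) → Φ p∈ ≋ Φ q∈ → p ≋ q
    Φ-injective {p} {q} p∈ q∈ e = mk≋ (φ-inj (p , ∈G p∈) (q , ∈G q∈) (app e))

    Φ-⨾ : ∀ {p q} (p∈ : G p) (q∈ : G q) → Φ (∈-⨾ p∈ q∈) ≋ (Φ p∈ ⨾ Φ q∈)
    Φ-⨾ {p} {q} p∈ q∈ = mk≋ (φ-hom p q (∈G p∈) (∈G q∈) (∈G (∈-⨾ p∈ q∈)))

    Φ-id : Φ ∈-id ≋ idP
    Φ-id = idempotent⇒id (≋-trans (≋-sym (Φ-⨾ ∈-id ∈-id)) (Φ-cong (∈-⨾ ∈-id ∈-id) ∈-id (mk≋ λ _ → refl)))

    Φ-⁻¹ : ∀ {p} (p∈ : G p) → Φ (∈-⁻¹ p∈) ≋ (Φ p∈ ⁻¹)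
    Φ-⁻¹ {p} p∈ = inverse-unique (≋-trans (≋-sym (Φ-⨾ (∈-⁻¹ p∈) p∈))
                                  (≋-trans (Φ-cong (∈-⨾ (∈-⁻¹ p∈) p∈) ∈-id (⁻¹-inverseˡ p)) Φ-id))

    Φ-^ : ∀ {p} k (p∈ : G p) → Φ (∈-^ k p∈) ≋ (Φ p∈ ^ k)
    Φ-^ zero p∈ = Φ-id
    Φ-^ (suc k) p∈ = ≋-trans (Φ-⨾ (∈-^ k p∈) p∈) (⨾-cong (Φ-^ k p∈) (≋-refl {p = Φ p∈}))

    Φ-conj : ∀ {h p} (h∈ : G h) (p∈ : G p) → Φ (∈-conj h∈ p∈) ≋ conj (Φ h∈) (Φ p∈)
    Φ-conj h∈ p∈ = ≋-trans (Φ-⨾ (∈-⨾ (∈-⁻¹ h∈) p∈) h∈)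
                     (⨾-cong (≋-trans (Φ-⨾ (∈-⁻¹ h∈) p∈) (⨾-cong (Φ-⁻¹ h∈) (≋-refl {p = Φ p∈}))) (≋-refl {p = Φ h∈}))

    module _ (r↦r⁻¹ : ∀ u → proj₁ u ≈ₚ r → proj₁ (φ u) ≈ₚ (r ⁻¹))
             (s↦s⁻¹ : ∀ u → proj₁ u ≈ₚ s → proj₁ (φ u) ≈ₚ (s ⁻¹)) where

      Φ-s : Φ s∈G ≋ (s ⁻¹)
      Φ-s = mk≋ (s↦s⁻¹ (s , ∈G s∈G) (λ _ → refl))

      Φ-r : Φ r∈G ≋ (r ⁻¹)
      Φ-r = mk≋ (r↦r⁻¹ (r , ∈G r∈G) (λ _ → refl))

      Φ-t : Φ t∈G ≋ conj (s ⁻¹) t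
      Φ-t = begin
        Φ t∈G                 ≈⟨ Φ-cong t∈G (∈-⨾ r∈G s∈G) (mk≋ λ x → sym (sfun-sinv (tfun x))) ⟩
        Φ (∈-⨾ r∈G s∈G)       ≈⟨ Φ-⨾ r∈G s∈G ⟩
        Φ r∈G ⨾ Φ s∈G         ≈⟨ ⨾-cong Φ-r Φ-s ⟩
        (r ⁻¹) ⨾ (s ⁻¹)       ≈⟨ mk≋ (λ _ → refl) ⟩
        conj (s ⁻¹) t         ∎
        where open ≋-Reasoning

      Φ-s^ : ∀ k → Φ (∈-^ k s∈G) ≋ ((s ^ k) ⁻¹)
      Φ-s^ k = ≋-trans (Φ-^ k s∈G) (≋-trans (^-cong k Φ-s) (⁻¹-^ s k))

      Φ-y : ∀ d → Φ (y∈G d) ≋ conj ((s ^ suc d) ⁻¹) (y d ⁻¹)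
      Φ-y d = ≋-trans expand (mk≋ λ x → trans (inner-l x) (sym (inner-r x)))
        where
        T S : Perm (Pt a i)
        T = conj (s ⁻¹) t
        S = (s ^ d) ⁻¹
        expand : Φ (y∈G d) ≋ (((T ⨾ S) ⨾ T) ⨾ S)
        expand = ≋-trans (Φ-⨾ _ (∈-^ d s∈G))
                   (⨾-cong (≋-trans (Φ-⨾ _ t∈G) (⨾-cong (≋-trans (Φ-⨾ t∈G (∈-^ d s∈G)) (⨾-cong Φ-t (Φ-s^ d))) Φ-t))
                           (Φ-s^ d))
        core : Pt a i → Pt a i
        core x = from (s ^ d) (sinv (tfun (from (s ^ d) (tfun (sfun x)))))
        inner-l : ∀ x → to (((T ⨾ S) ⨾ T) ⨾ S) x ≡ core x
        inner-l x = cong (λ z → from (s ^ d) (sinv (tfun z)))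
                         (trans (sym (s^-from-sfun d (sinv (tfun (sfun x))))) (cong (from (s ^ d)) (sfun-sinv (tfun (sfun x)))))
        inner-r : ∀ x → to (conj ((s ^ suc d) ⁻¹) (y d ⁻¹)) x ≡ core x
        inner-r x = cong (λ z → from (s ^ d) (sinv (tfun (from (s ^ d) (tfun z)))))
                         (trans (s^-from-sfun d (to (s ^ d) x)) (cong sfun (from∘to (s ^ d) x)))

      Φ-ascending : ∀ j d → Φ (ascending-pair∈G j d) ≋ conj ((s ^ suc (d + j)) ⁻¹) (y d ⁻¹)
      Φ-ascending j d = begin
        Φ (ascending-pair∈G j d)
          ≈⟨ Φ-cong (ascending-pair∈G j d) (∈-conj (∈-^ j s∈G) (y∈G d)) (≋-sym (conj-y≋pair j d)) ⟩
        Φ (∈-conj (∈-^ j s∈G) (y∈G d))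
          ≈⟨ Φ-conj (∈-^ j s∈G) (y∈G d) ⟩
        conj (Φ (∈-^ j s∈G)) (Φ (y∈G d))
          ≈⟨ ≋-trans (conj-congˡ (Φ (y∈G d)) (Φ-s^ j)) (conj-cong ((s ^ j) ⁻¹) (Φ-y d)) ⟩
        conj ((s ^ j) ⁻¹) (conj ((s ^ suc d) ⁻¹) (y d ⁻¹))
          ≈⟨ conj-conj ((s ^ suc d) ⁻¹) ((s ^ j) ⁻¹) (y d ⁻¹) ⟩
        conj (((s ^ suc d) ⁻¹) ⨾ ((s ^ j) ⁻¹)) (y d ⁻¹)
          ≈⟨ conj-congˡ (y d ⁻¹) (⁻¹-cong (≋-sym (^-+ s j (suc d)))) ⟩
        conj ((s ^ (j + suc d)) ⁻¹) (y d ⁻¹)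
          ≈⟨ ≋-reflexive (cong (λ k → conj ((s ^ k) ⁻¹) (y d ⁻¹)) (trans (ℕ.+-suc j d) (cong suc (ℕ.+-comm j d)))) ⟩
        conj ((s ^ suc (d + j)) ⁻¹) (y d ⁻¹)
          ∎
        where open ≋-Reasoning

      Φ-descending : ∀ J j d → Φ (pair∈G (d + j , j)) ≋ conj ((s ^ (J + suc (d + j))) ⁻¹) (pair (J , d + J))
      Φ-descending J j d = begin
        Φ (pair∈G (d + j , j))
          ≈⟨ Φ-cong (pair∈G (d + j , j)) (∈-⁻¹ (ascending-pair∈G j d)) (≋-sym (pair-⁻¹ j (d + j))) ⟩
        Φ (∈-⁻¹ (ascending-pair∈G j d))
          ≈⟨ Φ-⁻¹ (ascending-pair∈G j d) ⟩
        Φ (ascending-pair∈G j d) ⁻¹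
          ≈⟨ ⁻¹-cong (≋-trans (Φ-ascending j d) (≋-sym (conj-descending-pair J (suc (d + j)) d))) ⟩
        conj H (pair (d + J , J)) ⁻¹
          ≈⟨ conj-⁻¹ H (pair (d + J , J)) ⟨
        conj H (pair (d + J , J) ⁻¹)
          ≈⟨ conj-cong H (pair-⁻¹ (d + J) J) ⟩
        conj H (pair (J , d + J))
          ∎
        where
        open ≋-Reasoning
        H : Perm (Pt a i)
        H = (s ^ (J + suc (d + j))) ⁻¹

      Φ-A : Φ (word∈G A-word) ≋ conj ((s ^ 8) ⁻¹) (word B-word)
      Φ-A = begin
        Φ (word∈G A-word)                                      ≈⟨ Φ-⨾ (pair∈G (4 , 3)) (word∈G ((2 , 0) ∷ [])) ⟩
        Φ (pair∈G (4 , 3)) ⨾ Φ (word∈G ((2 , 0) ∷ []))         ≈⟨ ⨾-cong {p′ = conj H (pair (3 , 4))} {q′ = conj H (pair (5 , 7) ⨾ idP)}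
                                                                           (Φ-descending 3 3 1) second ⟩
        conj H (pair (3 , 4)) ⨾ conj H (pair (5 , 7) ⨾ idP)    ≈⟨ conj-⨾ H (pair (3 , 4)) (pair (5 , 7) ⨾ idP) ⟨
        conj H (word B-word)                                    ∎
        where
        open ≋-Reasoning
        H : Perm (Pt a i)
        H = (s ^ 8) ⁻¹
        second : Φ (word∈G ((2 , 0) ∷ [])) ≋ conj H (pair (5 , 7) ⨾ idP)
        second = begin
          Φ (word∈G ((2 , 0) ∷ []))             ≈⟨ Φ-⨾ (pair∈G (2 , 0)) ∈-id ⟩
          Φ (pair∈G (2 , 0)) ⨾ Φ ∈-id           ≈⟨ ⨾-cong {p′ = conj H (pair (5 , 7))} {q′ = conj H idP}
                                                           (Φ-descending 5 0 2) (≋-trans Φ-id (≋-sym (conj-id H))) ⟩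
          conj H (pair (5 , 7)) ⨾ conj H idP    ≈⟨ conj-⨾ H (pair (5 , 7)) idP ⟨
          conj H (pair (5 , 7) ⨾ idP)           ∎

      B^k≋id⇒A^k≋id : ∀ k → (word B-word ^ k) ≋ idP → (word A-word ^ k) ≋ idP
      B^k≋id⇒A^k≋id k B^k≋id = Φ-injective (∈-^ k (word∈G A-word)) ∈-id (begin
        Φ (∈-^ k (word∈G A-word))      ≈⟨ Φ-^ k (word∈G A-word) ⟩
        Φ (word∈G A-word) ^ k          ≈⟨ ^-cong k Φ-A ⟩
        conj H (word B-word) ^ k       ≈⟨ conj-^ H (word B-word) k ⟩
        conj H (word B-word ^ k)       ≈⟨ conj-cong H B^k≋id ⟩
        conj H idP                     ≈⟨ conj-id H ⟩
        idP                            ≈⟨ Φ-id ⟨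
        Φ ∈-id                         ∎)
        where
        open ≋-Reasoning
        H : Perm (Pt a i)
        H = (s ^ 8) ⁻¹

  module _ (K≤n : indexBound i ≤ nOf a i) where

    B^k≋id : (word {a} {i} B-word ^ separatingExponent i) ≋ idP
    B^k≋id = ≋-trans (word-^ B-word (separatingExponent i))
               (≋-trans (word≋ (concat (replicate (separatingExponent i) B-word))) (⟦⟧-agree K≤n (B-word-power-trivial i)))

    A^k≉id : ¬ ((word {a} {i} A-word ^ separatingExponent i) ≋ idP)
    A^k≉id A^k≋id = ⟦⟧-moves K≤n bounded z≤n moves
      (≋-trans (≋-sym (≋-trans (word-^ A-word (separatingExponent i)) (word≋ (concat (replicate (separatingExponent i) A-word))))) A^k≋id)
      where open MovesZero (A-word-power-moves-0 i)

    chiral : IsChiral (InG i) (rPerm i) (sPerm i)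
    chiral (A , r↦r⁻¹ , s↦s⁻¹) = A^k≉id (B^k≋id⇒A^k≋id A r↦r⁻¹ s↦s⁻¹ (separatingExponent i) B^k≋id)

proposition3p2 : (a : ℕ) (i : Sgn) → 1 ≤ a → 9 ≤ nOf a i →
    (∀ (p : Perm (Pt a i)) → InG i p ⇔ IsEven p)
    × HasOrder (rPerm {a} i) 4
    × HasOrder (sPerm {a} i) (nOf a i)
    × HasOrder (rPerm {a} i ⨾ sPerm {a} i) 2
    × IsChiral (InG i) (rPerm {a} i) (sPerm {a} i)
proposition3p2 a i 1≤a 9≤n =
    (λ p → mk⇔ (G⊆Alt {a} {i} {p}) (Alt⊆G {a} {i} K≤n {p}))
  , r-hasOrder i 1≤a
  , s-hasOrder
  , rs-hasOrder i
  , chiral K≤n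
  where
  K≤n : indexBound i ≤ nOf a i
  K≤n = indexBound≤n a i 9≤n
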